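{- For every even $n\geq 2$: $\mathcal M_{\Theta_e(n)}=\{\min(\Theta_e(n))\}$ and $\mathcal M_{\Lambda_e(n)}=\{\min(\Lambda_e(n))\}$, and $\min(\Theta_e(n))$ and $\min(\Lambda_e(n))$ belong to the basis of $B_{n-1}^{(prd)}$. For every odd $n\geq 3$: $\mathcal M_{\Theta_o(n)}=\{\min(\Theta_o(n))\}$ and $\mathcal M_{\Lambda_o(n)}=\{\min(\Lambda_o(n))\}$, and $\min(\Theta_o(n))$ and $\min(\Lambda_o(n))$ belong to the basis of $B_{n-1}^{(prd)}$.
   Context: Permutations are in one-line notation; $\sigma$ is a pattern of $\tau$ if some subsequence of $\tau$ is order-isomorphic to $\sigma$. A prefix reversal of a permutation reverses a prefix $\pi_1\cdots\pi_j$; $prd(\pi)$ is the minimum number of prefix reversals sorting $\pi$ to the identity; $B_k^{(prd)}$ is the set of all permutations (all lengths) with $prd\le k$, and its basis is the set of pattern-minimal permutations not in $B_k^{(prd)}$. A peg permutation of length $n$ is a word $\pi_1^{\varepsilon_1}\cdots\pi_n^{\varepsilon_n}$ with $\pi_1\cdots\pi_n$ a permutation of $\{1,\dots,n\}$ and $\varepsilon_i\in\{+,-,\bullet\}$. A prefix reversal of a peg permutation reverses a prefix and swaps $+\leftrightarrow-$ on the reversed entries; $prd(\pi^\varepsilon)$ is the minimum number of prefix reversals turning $\pi^\varepsilon$ into a peg permutation whose underlying permutation is the identity and all decorations are $+$ or $\bullet$. For a standard permutation $\gamma$, its strips are the maximal factors of consecutive positions whose values increase by $1$ at each step or decrease by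 $1$ at each step; $peg(\gamma)$ is obtained by replacing each strip by a single entry (its minimum value) decorated $+$ if it is an increasing strip of length $\ge2$, $-$ if a decreasing strip of length $\ge2$, $\bullet$ if of length $1$, and then standardizing the values (e.g. $peg(32451678)=2^-3^+1^\bullet4^+$). For a peg permutation $\pi^\varepsilon$, $\min(\pi^\varepsilon)$ is the permutation obtained by replacing each $\bullet$ entry by one entry and each $+$ (resp. $-$) entry by an increasing (resp. decreasing) run of $2$ consecutive values, values arranged so that block $i$ lies below block $j$ whenever $\pi_i<\pi_j$. $\mathcal M_{\pi^\varepsilon}$ is the set of permutations $\gamma$ that are pattern-minimal among all permutations satisfying $peg(\gamma)=\pi^\varepsilon$ and $prd(\gamma)=prd(\pi^\varepsilon)$. Exceptional permutations (all decorations $\bullet$ except the one indicated): for $n$ even, $\Theta_e(n)=n^\bullet(n-2)^\bullet\cdots4^\bullet2^\bullet\,1^+\,3^\bullet5^\bullet\cdots(n-1)^\bullet$, and with $t=n/2$, $\Lambda_e(n)$ has entries $t+j,\,t+1-j$ at positions $2j-1,2j$ ($j=1,\dots,t$), the first entry $(t+1)$ decorated $+$. For $n$ odd, $\Theta_o(n)=n^\bullet(n-2)^\bullet\cdots3^\bullet\,1^-\,2^\bullet4^\bullet\cdots(n-1)^\bullet$, and with $t=(n+1)/2$, $\Lambda_o(n)=t^-\,(t+1)^\bullet(t-1)^\bullet(t+2)^\bullet(t-2)^\bullet\cdots n^\bullet1^\bullet$ (first $t$, then the pairs $t+j,t-j$ for $j=1,\dots,(n-1)/2$). -}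

module Defs where

open import Data.Nat using (ℕ; zero; suc; _+_; _*_; _∸_; _≤_; _<_; _<?_; _≡ᵇ_; _/_; _⊓_)
open import Data.Nat.ListAction using (sum)
open import Data.Bool using (Bool; true; false; _∨_; if_then_else_)
open import Data.List using (List; []; _∷_; _++_; map; reverse; take; drop; length; filter; upTo; concatMap; zip; head)
open import Data.List.Relation.Unary.All using (All)
open import Data.List.Relation.Binary.Sublist.Propositional using (_⊆_)
open import Data.List.Relation.Binary.Permutation.Propositional using (_↭_)
open import Data.Product using (Σ; _×_; _,_; proj₁; proj₂; ∃)
open import Data.Maybe using (Maybe; just; nothing)
open import Relation.Binary.PropositionalEquality using (_≡_; _≢_)
open import Relation.Nullary using (¬_)

idPerm : ℕ → List ℕ
idPerm n = map suc (upTo n)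

IsPerm : List ℕ → Set
IsPerm xs = xs ↭ idPerm (length xs)

rank : ℕ → List ℕ → ℕ
rank x xs = length (filter (_<? x) xs)

-- standardization (order-isomorphic list on values 1..k, for distinct entries)
std : List ℕ → List ℕ
std xs = map (λ x → suc (rank x xs)) xs

_≼_ : List ℕ → List ℕ → Set
σ ≼ τ = Σ (List ℕ) λ s → (s ⊆ τ) × (std s ≡ σ)

prefRev : ℕ → List ℕ → List ℕ
prefRev j xs = reverse (take j xs) ++ drop j xs

applyRevs : List ℕ → List ℕ → List ℕ
applyRevs [] xs = xs
applyRevs (j ∷ js) xs = applyRevs js (prefRev j xs)

Sortable : ℕ → List ℕ → Set
Sortable k π = Σ (List ℕ) λ js → (length js ≤ k) × (applyRevs js π ≡ idPerm (length π))

PrdIs : List ℕ → ℕ → Set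
PrdIs π k = Sortable k π × (∀ m → m < k → ¬ Sortable m π)

InB : ℕ → List ℕ → Set
InB k π = IsPerm π × Sortable k π

InBasis : ℕ → List ℕ → Set
InBasis k σ = IsPerm σ × ¬ InB k σ ×
  (∀ τ → IsPerm τ → τ ≼ σ → τ ≢ σ → InB k τ)

data Deco : Set where
  plus minus dot : Deco

Peg : Set
Peg = List (ℕ × Deco)

flipD : Deco → Deco
flipD plus = minus
flipD minus = plus
flipD dot = dot

flipE : ℕ × Deco → ℕ × Deco
flipE (v , d) = (v , flipD d)

pegPrefRev : ℕ → Peg → Peg
pegPrefRev j xs = map flipE (reverse (take j xs)) ++ drop j xs

applyPegRevs : List ℕ → Peg → Peg
applyPegRevs [] xs = xs
applyPegRevs (j ∷ js) xs = applyPegRevs js (pegPrefRev j xs)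

PegSorted : Peg → Set
PegSorted p = (map proj₁ p ≡ idPerm (length p)) × All (λ e → proj₂ e ≢ minus) p

PegSortable : ℕ → Peg → Set
PegSortable k p = Σ (List ℕ) λ js → (length js ≤ k) × PegSorted (applyPegRevs js p)

PegPrdIs : Peg → ℕ → Set
PegPrdIs p k = PegSortable k p × (∀ m → m < k → ¬ PegSortable m p)

adjB : ℕ → ℕ → Bool
adjB x y = (x ≡ᵇ suc y) ∨ (y ≡ᵇ suc x)

-- decomposition into maximal factors of consecutive positions whose values
-- differ by 1 (in a permutation such a factor is monotone with step ±1)
strips : List ℕ → List (List ℕ)
strips [] = []
strips (x ∷ xs) with strips xs
... | [] = (x ∷ []) ∷ []
... | (y ∷ b) ∷ bs = if adjB x y then (x ∷ y ∷ b) ∷ bs else (x ∷ []) ∷ (y ∷ b) ∷ bs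
... | [] ∷ bs = (x ∷ []) ∷ [] ∷ bs

minL : List ℕ → ℕ
minL [] = 0
minL (x ∷ []) = x
minL (x ∷ y ∷ ys) = x ⊓ minL (y ∷ ys)

decoOf : List ℕ → Deco
decoOf (x ∷ y ∷ _) = if y ≡ᵇ suc x then plus else minus
decoOf _ = dot

peg : List ℕ → Peg
peg γ = zip (std (map minL (strips γ))) (map decoOf (strips γ))

sizeD : Deco → ℕ
sizeD dot = 1
sizeD plus = 2
sizeD minus = 2

base : ℕ → Peg → ℕ
base v p = sum (map (λ e → sizeD (proj₂ e)) (filter (λ e → proj₁ e <? v) p))

block : ℕ → Deco → List ℕ
block b dot = suc b ∷ []
block b plus = suc b ∷ suc (suc b) ∷ []
block b minus = suc (suc b) ∷ suc b ∷ []

minPeg : Peg → List ℕ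
minPeg p = concatMap (λ e → block (base (proj₁ e) p) (proj₂ e)) p

InC : Peg → List ℕ → Set
InC p γ = IsPerm γ × (peg γ ≡ p) × ∃ λ k → PrdIs γ k × PegPrdIs p k

InM : Peg → List ℕ → Set
InM p γ = InC p γ × (∀ δ → InC p δ → δ ≼ γ → δ ≡ γ)

MIsMin : Peg → Set
MIsMin p = ∀ γ → (InM p γ → γ ≡ minPeg p) × (γ ≡ minPeg p → InM p γ)

dotE : ℕ → ℕ × Deco
dotE v = (v , dot)

-- n even, t = n/2 : n (n-2) … 2  1⁺  3 5 … (n-1)
Θe : ℕ → Peg
Θe n = map (λ i → dotE (2 * (t ∸ i))) (upTo t) ++ ((1 , plus) ∷ map (λ i → dotE (2 * i + 3)) (upTo (t ∸ 1)))
  where t = n / 2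

-- n even, t = n/2 : entries t+j, t+1-j for j = 1..t, first decorated +
Λe : ℕ → Peg
Λe n = concatMap (λ i → (t + suc i , (if i ≡ᵇ 0 then plus else dot)) ∷ dotE (t ∸ i) ∷ []) (upTo t)
  where t = n / 2

-- n odd, s = (n-1)/2 : n (n-2) … 3  1⁻  2 4 … (n-1)
Θo : ℕ → Peg
Θo n = map (λ i → dotE (2 * (s ∸ i) + 1)) (upTo s) ++ ((1 , minus) ∷ map (λ i → dotE (2 * suc i)) (upTo s))
  where s = n / 2

-- n odd, t = (n+1)/2 : t⁻ then t+j, t-j for j = 1..(n-1)/2
Λo : ℕ → Peg
Λo n = (t , minus) ∷ concatMap (λ i → dotE (t + suc i) ∷ dotE (t ∸ suc i) ∷ []) (upTo s)
  where
  s = n / 2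
  t = suc s

-- The four peg permutations have minimal permutations min(p) of a very regular shape:
-- min(Θ) = N (N-2) (N-4) … (N-3) (N-1), and min(Λ) is obtained from the one two entries shorter
-- by shifting it up and appending N 1. A prefix reversal creates at most one adjacency (a pair of
-- consecutive values next to each other, counted with signs for peg permutations), and a sorted
-- list followed by its successor has one adjacency per entry; min(p) followed by its successor has
-- a single adjacency and p none, which bounds their prefix reversal distances from below. Explicit
-- reversal sequences give the matching upper bounds, and peeling off the two outermost entries
-- shows inductively that every proper pattern of min(p) sorts with one reversal fewer. Finally,
-- keeping the first two entries of every strip of any γ with peg γ = p yields a copy of min(p)
-- inside γ, so min(p) is the only pattern-minimal element of 𝓜_p, and it lies in the basis of the
-- class one level below.

module Submission where

open import Defs
open import Data.Bool using (Bool; true; false; _∨_; _∧_; if_then_else_; T)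
open import Data.Bool.Properties using (∨-comm; ∨-identityʳ)
open import Data.Empty using (⊥; ⊥-elim)
open import Data.List using (List; []; _∷_; _++_; [_]; map; reverse; take; drop; length; iterate;
    applyUpTo; upTo; concat; filter; concatMap; zip)
open import Data.List.Membership.Propositional using (_∈_; _∉_)
open import Data.List.Membership.Propositional.Properties using (∈-map⁺; ∈-∃++; ∈-++⁺ˡ; ∈-++⁺ʳ; ∈-concat⁺′)
open import Data.List.Properties using (length-++-comm; length-upTo; length-++; take++drop≡id;
    reverse-++; reverse-involutive; length-reverse; reverse-map; map-++; take-map; drop-map;
    take-all; drop-all; ++-assoc; unfold-reverse; map-applyUpTo; ++-identityʳ; length-++-≤ˡ;
    filter-accept; filter-reject; filter-++; map-cong; map-id-local; length-map; ∷-injective;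
    map-id; map-cong-local; concat-++; map-concatMap; concatMap-map; map-∘; upTo-∷ʳ; concatMap-++)
open import Data.List.Relation.Binary.Equality.Propositional using (≋⇒≡)
open import Data.List.Relation.Binary.Permutation.Propositional using (_↭_; ↭-refl; ↭-sym; ↭-trans;
    ↭-reflexive; ↭⇒↭ₛ)
import Data.List.Relation.Binary.Permutation.Propositional.Properties as PermP
open import Data.List.Relation.Binary.Sublist.Propositional using (_⊆_; []; _∷_; _∷ʳ_; minimum)
import Data.List.Relation.Binary.Sublist.Heterogeneous.Properties as SubH
import Data.List.Relation.Binary.Sublist.Propositional.Properties as SubP
open import Data.List.Relation.Unary.All using (All; []; _∷_)
import Data.List.Relation.Unary.All as All
import Data.List.Relation.Unary.All.Properties as AllP
open import Data.List.Relation.Unary.AllPairs using (AllPairs; []; _∷_)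
import Data.List.Relation.Unary.AllPairs as AllPairs
import Data.List.Relation.Unary.AllPairs.Properties as APP
open import Data.List.Relation.Unary.Any using (here; there)
import Data.List.Relation.Unary.Linked.Properties as LinkedP
import Data.List.Relation.Unary.Sorted.TotalOrder.Properties as SortedP
open import Data.List.Relation.Unary.Unique.Propositional using (Unique)
open import Data.Nat using (ℕ; zero; suc; pred; _+_; _∸_; _*_; _/_; _%_; _⊓_; _≤_; _<_; _≥_; z≤n;
    s≤s; s≤s⁻¹; _≟_; _<?_; _≡ᵇ_)
import Data.Nat.DivMod as DM
open import Data.Nat.Divisibility using (_∣_; divides)
import Data.Nat.Divisibility as Div
open import Data.Nat.ListAction using (sum)
open import Data.Nat.ListAction.Properties using (sum-++)
open import Data.Nat.Properties using (module ≤-Reasoning; ≤-refl; ≤-trans; ≤-antisym; ≤-reflexive;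
    ≤-totalOrder; <-trans; <-irrefl; <⇒≤; <⇒≱; ≮⇒≥; <-≤-trans; ≤∧≢⇒<; n≤1+n; m≤n⇒m≤1+n; m≤m+n;
    m≤n+m; +-suc; +-comm; +-assoc; +-identityʳ; +-monoʳ-≤; +-monoˡ-≤; *-comm; m∸n≤m; m+n∸n≡m;
    +-∸-assoc; m≤n⇒m∸n≡0; ⊓-zeroʳ; m≤n⇒m⊓n≡m; m≥n⇒m⊓n≡n; ≡ᵇ⇒≡)
open import Data.Product using (Σ; _×_; _,_; proj₁; proj₂)
open import Data.Sum using (_⊎_; inj₁; inj₂)
open import Function using (id; flip; _∘_)
open import Relation.Binary.PropositionalEquality using (_≡_; _≢_; refl; sym; trans; cong; cong₂;
    subst; subst₂; setoid; module ≡-Reasoning)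
open import Relation.Nullary using (¬_; Dec; yes; no)
import Data.List.Relation.Binary.Permutation.Setoid.Properties (setoid ℕ) as PermS

take-++ˡ : ∀ {A : Set} j (xs ys : List A) → j ≤ length xs → take j (xs ++ ys) ≡ take j xs
take-++ˡ zero xs ys p = refl
take-++ˡ (suc j) (x ∷ xs) ys (s≤s p) = cong (x ∷_) (take-++ˡ j xs ys p)

drop-++ˡ : ∀ {A : Set} j (xs ys : List A) → j ≤ length xs → drop j (xs ++ ys) ≡ drop j xs ++ ys
drop-++ˡ zero xs ys p = refl
drop-++ˡ (suc j) (x ∷ xs) ys (s≤s p) = drop-++ˡ j xs ys p

length-prefRev : ∀ j (xs : List ℕ) → length (prefRev j xs) ≡ length xs
length-prefRev j xs = begin
  length (reverse (take j xs) ++ drop j xs)      ≡⟨ length-++ (reverse (take j xs)) ⟩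
  length (reverse (take j xs)) + length (drop j xs) ≡⟨ cong (_+ length (drop j xs)) (length-reverse (take j xs)) ⟩
  length (take j xs) + length (drop j xs)        ≡⟨ sym (length-++ (take j xs)) ⟩
  length (take j xs ++ drop j xs)                ≡⟨ cong length (take++drop≡id j xs) ⟩
  length xs                                      ∎
  where open ≡-Reasoning

length-applyRevs : ∀ js (xs : List ℕ) → length (applyRevs js xs) ≡ length xs
length-applyRevs [] xs = refl
length-applyRevs (j ∷ js) xs = trans (length-applyRevs js (prefRev j xs)) (length-prefRev j xs)

prefRev-++ : ∀ j (xs ys : List ℕ) → j ≤ length xs → prefRev j (xs ++ ys) ≡ prefRev j xs ++ ys
prefRev-++ j xs ys p rewrite take-++ˡ j xs ys p | drop-++ˡ j xs ys p =
  sym (++-assoc (reverse (take j xs)) (drop j xs) ys)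

applyRevs-++ : ∀ js (xs ys : List ℕ) → All (_≤ length xs) js → applyRevs js (xs ++ ys) ≡ applyRevs js xs ++ ys
applyRevs-++ [] xs ys _ = refl
applyRevs-++ (j ∷ js) xs ys (p ∷ ps) rewrite prefRev-++ j xs ys p =
  applyRevs-++ js (prefRev j xs) ys (subst (λ m → All (_≤ m) js) (sym (length-prefRev j xs)) ps)

prefRev-map : ∀ (f : ℕ → ℕ) j xs → prefRev j (map f xs) ≡ map f (prefRev j xs)
prefRev-map f j xs rewrite take-map {f = f} j xs | drop-map {f = f} j xs =
  trans (cong (_++ map f (drop j xs)) (sym (reverse-map f (take j xs))))
        (sym (map-++ f (reverse (take j xs)) (drop j xs)))

applyRevs-map : ∀ (f : ℕ → ℕ) js xs → applyRevs js (map f xs) ≡ map f (applyRevs js xs)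
applyRevs-map f [] xs = refl
applyRevs-map f (j ∷ js) xs rewrite prefRev-map f j xs = applyRevs-map f js (prefRev j xs)

applyRevs-append : ∀ js ks (xs : List ℕ) → applyRevs (js ++ ks) xs ≡ applyRevs ks (applyRevs js xs)
applyRevs-append [] ks xs = refl
applyRevs-append (j ∷ js) ks xs = applyRevs-append js ks (prefRev j xs)

prefRev-whole : ∀ {j} (xs : List ℕ) → length xs ≡ j → prefRev j xs ≡ reverse xs
prefRev-whole xs refl rewrite take-all (length xs) xs ≤-refl | drop-all (length xs) xs ≤-refl = ++-identityʳ (reverse xs)

prefRev-whole-++ : ∀ {j} (xs ys : List ℕ) → length xs ≡ j → prefRev j (xs ++ ys) ≡ reverse xs ++ ys
prefRev-whole-++ xs ys refl = trans (prefRev-++ (length xs) xs ys ≤-refl) (cong (_++ ys) (prefRev-whole xs refl))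

prefRev-↭ : ∀ j (xs : List ℕ) → prefRev j xs ↭ xs
prefRev-↭ j xs = ↭-trans (PermP.++⁺ʳ (drop j xs) (PermP.↭-reverse (take j xs)))
                          (↭-reflexive (take++drop≡id j xs))

applyRevs-↭ : ∀ js (xs : List ℕ) → applyRevs js xs ↭ xs
applyRevs-↭ [] xs = ↭-refl
applyRevs-↭ (j ∷ js) xs = ↭-trans (applyRevs-↭ js (prefRev j xs)) (prefRev-↭ j xs)

⊆-split-++ : ∀ {A : Set} {s : List A} xs ys → s ⊆ xs ++ ys →
  Σ (List A) λ s₁ → Σ (List A) λ s₂ → (s ≡ s₁ ++ s₂) × (s₁ ⊆ xs) × (s₂ ⊆ ys)
⊆-split-++ [] ys p = [] , _ , refl , [] , p
⊆-split-++ (x ∷ xs) ys (.x ∷ʳ p) with ⊆-split-++ xs ys p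
... | s₁ , s₂ , e , q₁ , q₂ = s₁ , s₂ , e , (x ∷ʳ q₁) , q₂
⊆-split-++ (x ∷ xs) ys (refl ∷ p) with ⊆-split-++ xs ys p
... | s₁ , s₂ , e , q₁ , q₂ = x ∷ s₁ , s₂ , cong (x ∷_) e , (refl ∷ q₁) , q₂

⊆-map⁻ : ∀ {A B : Set} (f : A → B) {s} xs → s ⊆ map f xs → Σ (List A) λ s' → (s ≡ map f s') × (s' ⊆ xs)
⊆-map⁻ f [] [] = [] , refl , []
⊆-map⁻ f (x ∷ xs) (.(f x) ∷ʳ p) with ⊆-map⁻ f xs p
... | s' , e , q = s' , e , (x ∷ʳ q)
⊆-map⁻ f (x ∷ xs) (refl ∷ p) with ⊆-map⁻ f xs p
... | s' , e , q = x ∷ s' , cong (f x ∷_) e , (refl ∷ q)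

⊆-length⇒≡ : ∀ {A : Set} {s xs : List A} → s ⊆ xs → length xs ≤ length s → s ≡ xs
⊆-length⇒≡ p le = ≋⇒≡ (SubP.to-≋ (≤-antisym (SubP.length-mono-≤ p) le) p)

AllPairs-resp-⊆ : ∀ {A : Set} {R : A → A → Set} {s xs : List A} → s ⊆ xs → AllPairs R xs → AllPairs R s
AllPairs-resp-⊆ [] [] = []
AllPairs-resp-⊆ (y ∷ʳ p) (_ ∷ a) = AllPairs-resp-⊆ p a
AllPairs-resp-⊆ (refl ∷ p) (px ∷ a) = SubP.All-resp-⊆ p px ∷ AllPairs-resp-⊆ p a

-- The entries of s lying in the reversed prefix form a prefix of s; reversing it keeps s a sublist.
prefRev-⊆ : ∀ {s u : List ℕ} j → s ⊆ u → Σ ℕ λ j' → (j' ≤ length s) × (prefRev j' s ⊆ prefRev j u)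
prefRev-⊆ {s} {u} j p with ⊆-split-++ (take j u) (drop j u) (subst (s ⊆_) (sym (take++drop≡id j u)) p)
... | s₁ , s₂ , refl , q₁ , q₂ =
  length s₁ , length-++-≤ˡ s₁ ,
  subst (_⊆ prefRev j u) (sym (prefRev-whole-++ s₁ s₂ refl)) (SubH.++⁺ (SubH.reverse⁺ q₁) q₂)

applyRevs-⊆ : ∀ {s u : List ℕ} js → s ⊆ u →
  Σ (List ℕ) λ js' → (length js' ≡ length js) × All (_≤ length s) js' × (applyRevs js' s ⊆ applyRevs js u)
applyRevs-⊆ [] p = [] , refl , [] , p
applyRevs-⊆ {s} (j ∷ js) p with prefRev-⊆ j p
... | j' , le , q with applyRevs-⊆ js q
... | js' , e , bd , r = j' ∷ js' , cong suc e , le ∷ subst (λ m → All (_≤ m) js') (length-prefRev j' s) bd , r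

applyUpTo-iterate : ∀ (f : ℕ → ℕ) a n → (∀ i → f i ≡ a + i) → applyUpTo f n ≡ iterate suc a n
applyUpTo-iterate f a zero e = refl
applyUpTo-iterate f a (suc n) e = cong₂ _∷_ (trans (e 0) (+-identityʳ a))
  (applyUpTo-iterate (λ i → f (suc i)) (suc a) n (λ i → trans (e (suc i)) (+-suc a i)))

idPerm-iterate : ∀ n → idPerm n ≡ iterate suc 1 n
idPerm-iterate n = trans (map-applyUpTo id suc n) (applyUpTo-iterate suc 1 n (λ i → refl))

iterate-suc-∷ʳ : ∀ a n → iterate suc a (suc n) ≡ iterate suc a n ++ [ a + n ]
iterate-suc-∷ʳ a zero = cong [_] (sym (+-identityʳ a))
iterate-suc-∷ʳ a (suc n) = cong (a ∷_) (trans (iterate-suc-∷ʳ (suc a) n) (cong (λ z → iterate suc (suc a) n ++ [ z ]) (sym (+-suc a n))))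

map-suc-iterate : ∀ a n → map suc (iterate suc a n) ≡ iterate suc (suc a) n
map-suc-iterate a zero = refl
map-suc-iterate a (suc n) = cong (suc a ∷_) (map-suc-iterate (suc a) n)

iterate-suc-lower : ∀ a n → All (a ≤_) (iterate suc a n)
iterate-suc-lower a zero = []
iterate-suc-lower a (suc n) = ≤-refl ∷ All.map (≤-trans (n≤1+n a)) (iterate-suc-lower (suc a) n)

iterate-suc-upper : ∀ a n → All (_< a + n) (iterate suc a n)
iterate-suc-upper a zero = []
iterate-suc-upper a (suc n) =
  subst (a <_) (sym (+-suc a n)) (s≤s (m≤m+n a n)) ∷
  subst (λ z → All (_< z) (iterate suc (suc a) n)) (sym (+-suc a n)) (iterate-suc-upper (suc a) n)

iterate-suc-strictlySorted : ∀ a n → AllPairs _<_ (iterate suc a n)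
iterate-suc-strictlySorted a zero = []
iterate-suc-strictlySorted a (suc n) = iterate-suc-lower (suc a) n ∷ iterate-suc-strictlySorted (suc a) n

idPerm-∷ʳ : ∀ n → idPerm (suc n) ≡ idPerm n ++ [ suc n ]
idPerm-∷ʳ n = trans (idPerm-iterate (suc n)) (trans (iterate-suc-∷ʳ 1 n) (cong (_++ [ suc n ]) (sym (idPerm-iterate n))))

idPerm-∷ : ∀ n → idPerm (suc n) ≡ 1 ∷ map suc (idPerm n)
idPerm-∷ n = trans (idPerm-iterate (suc n))
  (cong (1 ∷_) (trans (sym (map-suc-iterate 1 n)) (cong (map suc) (sym (idPerm-iterate n)))))

idPerm-∷-∷ʳ : ∀ n → idPerm (suc (suc n)) ≡ 1 ∷ (map suc (idPerm n) ++ [ suc (suc n) ])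
idPerm-∷-∷ʳ n = begin
  idPerm (suc (suc n))                       ≡⟨ idPerm-∷ (suc n) ⟩
  1 ∷ map suc (idPerm (suc n))               ≡⟨ cong (λ l → 1 ∷ map suc l) (idPerm-∷ʳ n) ⟩
  1 ∷ map suc (idPerm n ++ [ suc n ])        ≡⟨ cong (1 ∷_) (map-++ suc (idPerm n) [ suc n ]) ⟩
  1 ∷ (map suc (idPerm n) ++ [ suc (suc n) ]) ∎
  where open ≡-Reasoning

length-idPerm : ∀ n → length (idPerm n) ≡ n
length-idPerm n = trans (length-map suc (upTo n)) (length-upTo n)

idPerm-strictlySorted : ∀ n → AllPairs _<_ (idPerm n)
idPerm-strictlySorted n = subst (AllPairs _<_) (sym (idPerm-iterate n)) (iterate-suc-strictlySorted 1 n)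

idPerm-sorted : ∀ n → AllPairs _≤_ (idPerm n)
idPerm-sorted n = AllPairs.map <⇒≤ (idPerm-strictlySorted n)

∈-idPerm : ∀ {n x} → x ∈ idPerm n → (1 ≤ x) × (x ≤ n)
∈-idPerm {n} m with subst (_ ∈_) (idPerm-iterate n) m
... | m' = All.lookup (iterate-suc-lower 1 n) m' , s≤s⁻¹ (All.lookup (iterate-suc-upper 1 n) m')

↭idPerm-bounds : ∀ {xs} n → xs ↭ idPerm n → All (λ x → (1 ≤ x) × (x ≤ n)) xs
↭idPerm-bounds n p = All.tabulate (λ m → ∈-idPerm (PermP.∈-resp-↭ p m))

↭idPerm-upper : ∀ {xs} n → xs ↭ idPerm n → All (_≤ n) xs
↭idPerm-upper n p = All.map proj₂ (↭idPerm-bounds n p)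

↭idPerm-lower : ∀ {xs} n → xs ↭ idPerm n → All (1 ≤_) xs
↭idPerm-lower n p = All.map proj₁ (↭idPerm-bounds n p)

IsPerm⇒Unique : ∀ xs → IsPerm xs → Unique xs
IsPerm⇒Unique xs p =
  PermS.Unique-resp-↭ (↭⇒↭ₛ (↭-sym p)) (AllPairs.map (λ x<y x≡y → <-irrefl x≡y x<y) (idPerm-strictlySorted (length xs)))

rank-↭ : ∀ x {xs ys} → xs ↭ ys → rank x xs ≡ rank x ys
rank-↭ x p = PermP.↭-length (PermP.filter-↭ (_<? x) p)

rank-∷-< : ∀ {x a} s → a < x → rank x (a ∷ s) ≡ suc (rank x s)
rank-∷-< {x} s p = cong length (filter-accept (_<? x) p)

rank-∷-≮ : ∀ {x a} s → ¬ a < x → rank x (a ∷ s) ≡ rank x s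
rank-∷-≮ {x} s p = cong length (filter-reject (_<? x) p)

rank-++ : ∀ x xs ys → rank x (xs ++ ys) ≡ rank x xs + rank x ys
rank-++ x xs ys = trans (cong length (filter-++ (_<? x) xs ys)) (length-++ (filter (_<? x) xs))

rank-iterate-suc : ∀ x a n → rank x (iterate suc a n) ≡ (x ∸ a) ⊓ n
rank-iterate-suc x a zero = sym (⊓-zeroʳ (x ∸ a))
rank-iterate-suc x a (suc n) with a <? x
... | yes a<x = begin
  rank x (iterate suc a (suc n))       ≡⟨ rank-∷-< (iterate suc (suc a) n) a<x ⟩
  suc (rank x (iterate suc (suc a) n)) ≡⟨ cong suc (rank-iterate-suc x (suc a) n) ⟩
  suc ((x ∸ suc a) ⊓ n)                ≡⟨ cong (_⊓ suc n) (sym (+-∸-assoc 1 a<x)) ⟩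
  (x ∸ a) ⊓ suc n                      ∎
  where open ≡-Reasoning
... | no a≮x = begin
  rank x (iterate suc a (suc n)) ≡⟨ rank-∷-≮ (iterate suc (suc a) n) a≮x ⟩
  rank x (iterate suc (suc a) n) ≡⟨ rank-iterate-suc x (suc a) n ⟩
  (x ∸ suc a) ⊓ n                ≡⟨ cong (_⊓ n) (m≤n⇒m∸n≡0 (≤-trans (≮⇒≥ a≮x) (n≤1+n a))) ⟩
  0                              ≡⟨ cong (_⊓ suc n) (sym (m≤n⇒m∸n≡0 (≮⇒≥ a≮x))) ⟩
  (x ∸ a) ⊓ suc n                ∎
  where open ≡-Reasoning

rank-mono : ∀ {x y} → x ≤ y → ∀ s → rank x s ≤ rank y s
rank-mono le [] = z≤n
rank-mono {x} {y} le (z ∷ s) with z <? x | z <? y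
... | yes p | yes q rewrite rank-∷-< {x} s p | rank-∷-< {y} s q = s≤s (rank-mono le s)
... | yes p | no q = ⊥-elim (q (<-≤-trans p le))
... | no p | yes q rewrite rank-∷-≮ {x} s p | rank-∷-< {y} s q = m≤n⇒m≤1+n (rank-mono le s)
... | no p | no q rewrite rank-∷-≮ {x} s p | rank-∷-≮ {y} s q = rank-mono le s

std-IsPerm : ∀ xs → IsPerm xs → std xs ≡ xs
std-IsPerm xs p = map-id-local (All.tabulate (λ {x} m → rank+1≡ x (∈-idPerm (PermP.∈-resp-↭ p m))))
  where
  open ≡-Reasoning
  N = length xs
  rank+1≡ : ∀ x → (1 ≤ x) × (x ≤ N) → suc (rank x xs) ≡ x
  rank+1≡ zero (() , _)
  rank+1≡ (suc x) (_ , x<N) = cong suc (begin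
    rank (suc x) xs                      ≡⟨ rank-↭ (suc x) (subst (xs ↭_) (idPerm-iterate N) p) ⟩
    rank (suc x) (iterate suc 1 N)       ≡⟨ rank-iterate-suc (suc x) 1 N ⟩
    x ⊓ N                                ≡⟨ m≤n⇒m⊓n≡m (≤-trans (n≤1+n x) x<N) ⟩
    x                                    ∎)

std-applyRevs : ∀ js s → std (applyRevs js s) ≡ applyRevs js (std s)
std-applyRevs js s = trans (map-cong (λ x → cong suc (rank-↭ x (applyRevs-↭ js s))) (applyRevs js s))
                           (sym (applyRevs-map (λ x → suc (rank x s)) js s))

std-sorted : ∀ s → AllPairs _≤_ s → AllPairs _≤_ (std s)
std-sorted s sorted = APP.map⁺ (AllPairs.map (λ le → s≤s (rank-mono le s)) sorted)

sorted-↭⇒≡ : ∀ {xs ys} → xs ↭ ys → AllPairs _≤_ xs → AllPairs _≤_ ys → xs ≡ ys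
sorted-↭⇒≡ p sx sy = ≋⇒≡ (SortedP.↗↭↗⇒≋ ≤-totalOrder (LinkedP.AllPairs⇒Linked sx) (LinkedP.AllPairs⇒Linked sy) (↭⇒↭ₛ p))

Sortable-fromPattern : ∀ k {τ s} → IsPerm τ → std s ≡ τ → (js : List ℕ) → length js ≤ k →
  AllPairs _≤_ (applyRevs js s) → Sortable k τ
Sortable-fromPattern k {τ} {s} pτ refl js le sorted =
  js , le , sorted-↭⇒≡ (↭-trans (applyRevs-↭ js τ) pτ)
    (subst (AllPairs _≤_) (std-applyRevs js s) (std-sorted _ sorted)) (idPerm-sorted (length τ))

-- The bound on the reversal lengths keeps the sequence meaningful after appending entries to xs.
ChainSortable : (ℕ → ℕ → Set) → ℕ → List ℕ → Set
ChainSortable R k xs = Σ (List ℕ) λ js → (length js ≤ k) × All (_≤ length xs) js × AllPairs R (applyRevs js xs)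

ChainSortable-by : ∀ {R k xs} js ys → applyRevs js xs ≡ ys → AllPairs R ys → length js ≤ k →
  All (_≤ length xs) js → ChainSortable R k xs
ChainSortable-by js ys e srt le bd = js , le , bd , subst (AllPairs _) (sym e) srt

ChainSortable-weaken : ∀ {R k k' xs} → k ≤ k' → ChainSortable R k xs → ChainSortable R k' xs
ChainSortable-weaken le (js , a , b , c) = js , ≤-trans a le , b , c

ChainSortable-⊆ : ∀ {R k s u} → s ⊆ u → ChainSortable R k u → ChainSortable R k s
ChainSortable-⊆ {R} {k} {s} p (js , le , bd , srt) with applyRevs-⊆ js p
... | js' , e , bd' , q = js' , subst (_≤ k) (sym e) le , bd' , AllPairs-resp-⊆ q srt

ChainSortable-short : ∀ {R k} xs → length xs ≤ 1 → ChainSortable R k xs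
ChainSortable-short [] _ = [] , z≤n , [] , []
ChainSortable-short (x ∷ []) _ = [] , z≤n , [] , ([] ∷ [])
ChainSortable-short (x ∷ y ∷ xs) (s≤s ())

All-applyRevs : ∀ {P : ℕ → Set} js xs → All P xs → All P (applyRevs js xs)
All-applyRevs js xs a = PermP.All-resp-↭ (↭-sym (applyRevs-↭ js xs)) a

AllPairs-∷ʳ : ∀ {A : Set} {R : A → A → Set} {xs z} → AllPairs R xs → All (λ x → R x z) xs → AllPairs R (xs ++ [ z ])
AllPairs-∷ʳ ap al = APP.++⁺ ap ([] ∷ []) (All.map (_∷ []) al)

AllPairs-reverse : ∀ {A : Set} {R : A → A → Set} {xs} → AllPairs R xs → AllPairs (flip R) (reverse xs)
AllPairs-reverse [] = []
AllPairs-reverse {R = R} {xs = x ∷ xs} (p ∷ ps) =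
  subst (AllPairs (flip R)) (sym (unfold-reverse x xs))
    (AllPairs-∷ʳ (AllPairs-reverse ps) (PermP.All-resp-↭ (↭-sym (PermP.↭-reverse xs)) p))

ChainSortable-∷ʳ : ∀ {R k xs z} → All (λ x → R x z) xs → ChainSortable R k xs → ChainSortable R k (xs ++ [ z ])
ChainSortable-∷ʳ {R} {k} {xs} {z} al (js , le , bd , srt) =
  js , le , All.map (λ p → ≤-trans p (subst (length xs ≤_) (sym (length-++ xs)) (m≤m+n _ _))) bd ,
  subst (AllPairs R) (sym (applyRevs-++ js xs [ z ] bd)) (AllPairs-∷ʳ srt (All-applyRevs js xs al))

ChainSortable-reverse : ∀ {R k xs} → ChainSortable R k (reverse xs) → ChainSortable R (suc k) xs
ChainSortable-reverse {R} {k} {xs} (js , le , bd , srt) =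
  length xs ∷ js , s≤s le , ≤-refl ∷ subst (λ m → All (_≤ m) js) (length-reverse xs) bd ,
  subst (AllPairs R) (cong (applyRevs js) (sym (prefRev-whole xs refl))) srt

ChainSortable-flip : ∀ {R k xs} → ChainSortable (flip R) k xs → ChainSortable R (suc k) xs
ChainSortable-flip {R} {k} {xs} (js , le , bd , srt) =
  js ++ [ length xs ] , subst (_≤ suc k) (sym (trans (length-++ js) (+-comm (length js) 1))) (s≤s le) ,
  AllP.++⁺ bd (≤-refl ∷ []) ,
  subst (AllPairs R) (sym reversed) (AllPairs-reverse srt)
  where
  reversed : applyRevs (js ++ [ length xs ]) xs ≡ reverse (applyRevs js xs)
  reversed = trans (applyRevs-append js [ length xs ] xs)
    (prefRev-whole (applyRevs js xs) (length-applyRevs js xs))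

indicator : Bool → ℕ
indicator true = 1
indicator false = 0

indicator≤1 : ∀ b → indicator b ≤ 1
indicator≤1 true = ≤-refl
indicator≤1 false = z≤n

adjacencies : {A : Set} → (A → A → Bool) → List A → ℕ
adjacencies r [] = 0
adjacencies r (x ∷ []) = 0
adjacencies r (x ∷ y ∷ xs) = indicator (r x y) + adjacencies r (y ∷ xs)

module _ {A : Set} (r : A → A → Bool) where

  adjacencies-∷-≤ : ∀ x xs → adjacencies r (x ∷ xs) ≤ suc (adjacencies r xs)
  adjacencies-∷-≤ x [] = z≤n
  adjacencies-∷-≤ x (y ∷ xs) = +-monoˡ-≤ (adjacencies r (y ∷ xs)) (indicator≤1 (r x y))

  adjacencies-∷-≥ : ∀ x xs → adjacencies r xs ≤ adjacencies r (x ∷ xs)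
  adjacencies-∷-≥ x [] = z≤n
  adjacencies-∷-≥ x (y ∷ xs) = m≤n+m (adjacencies r (y ∷ xs)) (indicator (r x y))

  adjacencies-++-≤ : ∀ xs ys → adjacencies r (xs ++ ys) ≤ adjacencies r xs + suc (adjacencies r ys)
  adjacencies-++-≤ [] ys = n≤1+n (adjacencies r ys)
  adjacencies-++-≤ (x ∷ []) ys = adjacencies-∷-≤ x ys
  adjacencies-++-≤ (x ∷ y ∷ xs) ys = ≤-trans
    (+-monoʳ-≤ (indicator (r x y)) (adjacencies-++-≤ (y ∷ xs) ys))
    (≤-reflexive (sym (+-assoc (indicator (r x y)) _ _)))

  adjacencies-++-≥ : ∀ xs ys → adjacencies r xs + adjacencies r ys ≤ adjacencies r (xs ++ ys)
  adjacencies-++-≥ [] ys = ≤-refl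
  adjacencies-++-≥ (x ∷ []) ys = adjacencies-∷-≥ x ys
  adjacencies-++-≥ (x ∷ y ∷ xs) ys = ≤-trans
    (≤-reflexive (+-assoc (indicator (r x y)) _ _))
    (+-monoʳ-≤ (indicator (r x y)) (adjacencies-++-≥ (y ∷ xs) ys))

  adjacencies-∷ʳ : ∀ xs y z → adjacencies r ((xs ++ [ y ]) ++ [ z ]) ≡ adjacencies r (xs ++ [ y ]) + indicator (r y z)
  adjacencies-∷ʳ [] y z = +-identityʳ (indicator (r y z))
  adjacencies-∷ʳ (x ∷ []) y z = trans (cong (indicator (r x y) +_) (+-identityʳ (indicator (r y z))))
    (cong (_+ indicator (r y z)) (sym (+-identityʳ (indicator (r x y)))))
  adjacencies-∷ʳ (x ∷ x' ∷ xs) y z = trans (cong (indicator (r x x') +_) (adjacencies-∷ʳ (x' ∷ xs) y z))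
    (sym (+-assoc (indicator (r x x')) _ _))

  -- The only adjacency that can appear is the one at the junction of the new prefix with ys.
  adjacencies-replacePrefix : ∀ xs xs' ys → adjacencies r xs' ≡ adjacencies r xs →
    adjacencies r (xs' ++ ys) ≤ suc (adjacencies r (xs ++ ys))
  adjacencies-replacePrefix xs xs' ys e = begin
    adjacencies r (xs' ++ ys)                   ≤⟨ adjacencies-++-≤ xs' ys ⟩
    adjacencies r xs' + suc (adjacencies r ys)  ≡⟨ cong (_+ suc (adjacencies r ys)) e ⟩
    adjacencies r xs + suc (adjacencies r ys)   ≡⟨ +-suc (adjacencies r xs) (adjacencies r ys) ⟩
    suc (adjacencies r xs + adjacencies r ys)   ≤⟨ s≤s (adjacencies-++-≥ xs ys) ⟩
    suc (adjacencies r (xs ++ ys))              ∎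
    where open ≤-Reasoning

  adjacencies-reverse : (g : A → A) → (∀ x y → r (g y) (g x) ≡ r x y) →
    ∀ xs → adjacencies r (map g (reverse xs)) ≡ adjacencies r xs
  adjacencies-reverse g r-g [] = refl
  adjacencies-reverse g r-g (x ∷ []) = refl
  adjacencies-reverse g r-g (x ∷ y ∷ xs) = begin
    adjacencies r (map g (reverse (x ∷ y ∷ xs)))
      ≡⟨ cong (adjacencies r) (map-reverse-∷-∷ x y xs) ⟩
    adjacencies r ((map g (reverse xs) ++ [ g y ]) ++ [ g x ])
      ≡⟨ adjacencies-∷ʳ (map g (reverse xs)) (g y) (g x) ⟩
    adjacencies r (map g (reverse xs) ++ [ g y ]) + indicator (r (g y) (g x))
      ≡⟨ cong₂ (λ a b → adjacencies r a + indicator b) (sym (map-reverse-∷ y xs)) (r-g x y) ⟩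
    adjacencies r (map g (reverse (y ∷ xs))) + indicator (r x y)
      ≡⟨ cong (_+ indicator (r x y)) (adjacencies-reverse g r-g (y ∷ xs)) ⟩
    adjacencies r (y ∷ xs) + indicator (r x y)
      ≡⟨ +-comm (adjacencies r (y ∷ xs)) (indicator (r x y)) ⟩
    adjacencies r (x ∷ y ∷ xs) ∎
    where
    open ≡-Reasoning
    map-reverse-∷ : ∀ z zs → map g (reverse (z ∷ zs)) ≡ map g (reverse zs) ++ [ g z ]
    map-reverse-∷ z zs = trans (cong (map g) (unfold-reverse z zs)) (map-++ g (reverse zs) [ z ])
    map-reverse-∷-∷ : ∀ z z' zs → map g (reverse (z ∷ z' ∷ zs)) ≡ (map g (reverse zs) ++ [ g z' ]) ++ [ g z ]
    map-reverse-∷-∷ z z' zs = trans (map-reverse-∷ z (z' ∷ zs)) (cong (_++ [ g z ]) (map-reverse-∷ z' zs))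

adjacencies-map : ∀ {A B : Set} (r : A → A → Bool) (r' : B → B → Bool) (f : A → B) →
  (∀ x y → r' (f x) (f y) ≡ r x y) → ∀ xs → adjacencies r' (map f xs) ≡ adjacencies r xs
adjacencies-map r r' f r-f [] = refl
adjacencies-map r r' f r-f (x ∷ []) = refl
adjacencies-map r r' f r-f (x ∷ y ∷ xs) = cong₂ _+_ (cong indicator (r-f x y)) (adjacencies-map r r' f r-f (y ∷ xs))

≡ᵇ-refl : ∀ n → (n ≡ᵇ n) ≡ true
≡ᵇ-refl zero = refl
≡ᵇ-refl (suc n) = ≡ᵇ-refl n

adjB-sym : ∀ x y → adjB y x ≡ adjB x y
adjB-sym x y = ∨-comm (y ≡ᵇ suc x) (x ≡ᵇ suc y)

adjB-suc : ∀ a → adjB a (suc a) ≡ true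
adjB-suc zero = refl
adjB-suc (suc a) = adjB-suc a

adjacencies-prefRev : ∀ j xs z → adjacencies adjB (prefRev j xs ++ z) ≤ suc (adjacencies adjB (xs ++ z))
adjacencies-prefRev j xs z =
  subst₂ (λ a b → adjacencies adjB a ≤ suc (adjacencies adjB b))
    (sym (++-assoc (reverse (take j xs)) (drop j xs) z))
    (trans (sym (++-assoc (take j xs) (drop j xs) z)) (cong (_++ z) (take++drop≡id j xs)))
    (adjacencies-replacePrefix adjB (take j xs) (reverse (take j xs)) (drop j xs ++ z)
      (trans (cong (adjacencies adjB) (sym (map-id (reverse (take j xs)))))
             (adjacencies-reverse adjB id adjB-sym (take j xs))))

adjacencies-applyRevs : ∀ js xs z → adjacencies adjB (applyRevs js xs ++ z) ≤ length js + adjacencies adjB (xs ++ z)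
adjacencies-applyRevs [] xs z = ≤-refl
adjacencies-applyRevs (j ∷ js) xs z = ≤-trans (adjacencies-applyRevs js (prefRev j xs) z)
  (≤-trans (+-monoʳ-≤ (length js) (adjacencies-prefRev j xs z)) (≤-reflexive (+-suc (length js) _)))

adjacencies-iterate-suc : ∀ a n → adjacencies adjB (iterate suc a n ++ [ a + n ]) ≡ n
adjacencies-iterate-suc a zero = refl
adjacencies-iterate-suc a (suc zero) rewrite +-suc a 0 | +-identityʳ a | adjB-suc a = refl
adjacencies-iterate-suc a (suc (suc n)) = begin
  indicator (adjB a (suc a)) + adjacencies adjB (iterate suc (suc a) (suc n) ++ [ a + suc (suc n) ])
    ≡⟨ cong₂ (λ b c → indicator b + adjacencies adjB (iterate suc (suc a) (suc n) ++ [ c ])) (adjB-suc a) (+-suc a (suc n)) ⟩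
  suc (adjacencies adjB (iterate suc (suc a) (suc n) ++ [ suc a + suc n ]))
    ≡⟨ cong suc (adjacencies-iterate-suc (suc a) (suc n)) ⟩
  suc (suc n) ∎
  where open ≡-Reasoning

notMinus : Deco → Bool
notMinus minus = false
notMinus _ = true

notPlus : Deco → Bool
notPlus plus = false
notPlus _ = true

-- Consecutive entries in the order of a sorted peg permutation (read forwards, or backwards with flipped signs).
pegAdj : ℕ × Deco → ℕ × Deco → Bool
pegAdj (x , d) (y , e) = (notMinus d ∧ (notMinus e ∧ (y ≡ᵇ suc x))) ∨ (notPlus d ∧ (notPlus e ∧ (x ≡ᵇ suc y)))

pegAdj-flip : ∀ a b → pegAdj (flipE b) (flipE a) ≡ pegAdj a b
pegAdj-flip (x , plus) (y , plus) = sym (∨-identityʳ _)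
pegAdj-flip (x , plus) (y , minus) = refl
pegAdj-flip (x , plus) (y , dot) = sym (∨-identityʳ _)
pegAdj-flip (x , minus) (y , plus) = refl
pegAdj-flip (x , minus) (y , minus) = ∨-identityʳ _
pegAdj-flip (x , minus) (y , dot) = ∨-identityʳ _
pegAdj-flip (x , dot) (y , plus) = sym (∨-identityʳ _)
pegAdj-flip (x , dot) (y , minus) = ∨-identityʳ _
pegAdj-flip (x , dot) (y , dot) = ∨-comm (x ≡ᵇ suc y) (y ≡ᵇ suc x)

pegAdj-suc : ∀ a d e → d ≢ minus → e ≢ minus → pegAdj (a , d) (suc a , e) ≡ true
pegAdj-suc a plus plus _ _ rewrite ≡ᵇ-refl a = refl
pegAdj-suc a plus minus _ e≢ = ⊥-elim (e≢ refl)
pegAdj-suc a plus dot _ _ rewrite ≡ᵇ-refl a = refl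
pegAdj-suc a minus e d≢ _ = ⊥-elim (d≢ refl)
pegAdj-suc a dot plus _ _ rewrite ≡ᵇ-refl a = refl
pegAdj-suc a dot minus _ e≢ = ⊥-elim (e≢ refl)
pegAdj-suc a dot dot _ _ rewrite ≡ᵇ-refl a = refl

length-pegPrefRev : ∀ j (xs : Peg) → length (pegPrefRev j xs) ≡ length xs
length-pegPrefRev j xs = begin
  length (map flipE (reverse (take j xs)) ++ drop j xs)       ≡⟨ length-++ (map flipE (reverse (take j xs))) ⟩
  length (map flipE (reverse (take j xs))) + length (drop j xs) ≡⟨ cong (_+ length (drop j xs)) (trans (length-map flipE (reverse (take j xs))) (length-reverse (take j xs))) ⟩
  length (take j xs) + length (drop j xs)                     ≡⟨ sym (length-++ (take j xs)) ⟩
  length (take j xs ++ drop j xs)                             ≡⟨ cong length (take++drop≡id j xs) ⟩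
  length xs                                                   ∎
  where open ≡-Reasoning

length-applyPegRevs : ∀ js (xs : Peg) → length (applyPegRevs js xs) ≡ length xs
length-applyPegRevs [] xs = refl
length-applyPegRevs (j ∷ js) xs = trans (length-applyPegRevs js (pegPrefRev j xs)) (length-pegPrefRev j xs)

adjacencies-pegPrefRev : ∀ j xs z → adjacencies pegAdj (pegPrefRev j xs ++ z) ≤ suc (adjacencies pegAdj (xs ++ z))
adjacencies-pegPrefRev j xs z =
  subst₂ (λ a b → adjacencies pegAdj a ≤ suc (adjacencies pegAdj b))
    (sym (++-assoc (map flipE (reverse (take j xs))) (drop j xs) z))
    (trans (sym (++-assoc (take j xs) (drop j xs) z)) (cong (_++ z) (take++drop≡id j xs)))
    (adjacencies-replacePrefix pegAdj (take j xs) (map flipE (reverse (take j xs))) (drop j xs ++ z)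
      (adjacencies-reverse pegAdj flipE pegAdj-flip (take j xs)))

adjacencies-applyPegRevs : ∀ js xs z → adjacencies pegAdj (applyPegRevs js xs ++ z) ≤ length js + adjacencies pegAdj (xs ++ z)
adjacencies-applyPegRevs [] xs z = ≤-refl
adjacencies-applyPegRevs (j ∷ js) xs z = ≤-trans (adjacencies-applyPegRevs js (pegPrefRev j xs) z)
  (≤-trans (+-monoʳ-≤ (length js) (adjacencies-pegPrefRev j xs z)) (≤-reflexive (+-suc (length js) _)))

adjacencies-pegIterate : ∀ a (p : Peg) → map proj₁ p ≡ iterate suc a (length p) → All (λ e → proj₂ e ≢ minus) p →
  adjacencies pegAdj (p ++ [ (a + length p , plus) ]) ≡ length p
adjacencies-pegIterate a [] e al = refl
adjacencies-pegIterate a ((v , d) ∷ []) e (d≢ ∷ al) with ∷-injective e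
... | refl , _ rewrite +-suc a 0 | +-identityʳ a | pegAdj-suc a d plus d≢ (λ ()) = refl
adjacencies-pegIterate a ((v , d) ∷ (v' , d') ∷ p) e (d≢ ∷ d'≢ ∷ al)
  with ∷-injective e | adjacencies-pegIterate (suc a) ((v' , d') ∷ p) (proj₂ (∷-injective e)) (d'≢ ∷ al)
... | refl , e' | ih with ∷-injective e'
... | refl , _ rewrite pegAdj-suc a d d' d≢ d'≢ =
  cong suc (trans (cong (λ q → adjacencies pegAdj (((suc a , d') ∷ p) ++ [ (q , plus) ])) (+-suc a (suc (length p)))) ih)

Sortable⇒length≤ : ∀ m xs → Sortable m xs → length xs ≤ m + adjacencies adjB (xs ++ [ suc (length xs) ])
Sortable⇒length≤ m xs (js , le , sorted) = begin
  length xs                                                          ≡⟨ sym (adjacencies-iterate-suc 1 (length xs)) ⟩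
  adjacencies adjB (iterate suc 1 (length xs) ++ [ suc (length xs) ]) ≡⟨ cong (λ q → adjacencies adjB (q ++ [ suc (length xs) ])) (sym (trans sorted (idPerm-iterate (length xs)))) ⟩
  adjacencies adjB (applyRevs js xs ++ [ suc (length xs) ])          ≤⟨ adjacencies-applyRevs js xs [ suc (length xs) ] ⟩
  length js + adjacencies adjB (xs ++ [ suc (length xs) ])           ≤⟨ +-monoˡ-≤ _ le ⟩
  m + adjacencies adjB (xs ++ [ suc (length xs) ])                   ∎
  where open ≤-Reasoning

PegSortable⇒length≤ : ∀ m p → PegSortable m p → length p ≤ m + adjacencies pegAdj (p ++ [ (suc (length p) , plus) ])
PegSortable⇒length≤ m p (js , le , (sorted , noMinus)) = begin
  length p                                                            ≡⟨ sym |p'| ⟩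
  length p'                                                           ≡⟨ sym (adjacencies-pegIterate 1 p' (trans sorted (idPerm-iterate _)) noMinus) ⟩
  adjacencies pegAdj (p' ++ [ (suc (length p') , plus) ])             ≡⟨ cong (λ q → adjacencies pegAdj (p' ++ [ (suc q , plus) ])) |p'| ⟩
  adjacencies pegAdj (p' ++ [ (suc (length p) , plus) ])              ≤⟨ adjacencies-applyPegRevs js p [ (suc (length p) , plus) ] ⟩
  length js + adjacencies pegAdj (p ++ [ (suc (length p) , plus) ])   ≤⟨ +-monoˡ-≤ _ le ⟩
  m + adjacencies pegAdj (p ++ [ (suc (length p) , plus) ])           ∎
  where
  open ≤-Reasoning
  p' = applyPegRevs js p
  |p'| : length p' ≡ length p
  |p'| = length-applyPegRevs js p

upRun : ℕ → ℕ → List ℕ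
upRun m zero = [ m ]
upRun m (suc k) = m ∷ upRun (suc m) k

downRun : ℕ → ℕ → List ℕ
downRun m zero = [ m ]
downRun m (suc k) = suc (k + m) ∷ downRun m k

-- In a list of distinct values every strip is a run: an interval of values in increasing or decreasing order.
data Run : List ℕ → Set where
  singleton : ∀ x → Run [ x ]
  ascending : ∀ m k → Run (upRun m (suc k))
  descending : ∀ m k → Run (downRun m (suc k))

rmin : ∀ {b} → Run b → ℕ
rmin (singleton x) = x
rmin (ascending m k) = m
rmin (descending m k) = m

rlen : ∀ {b} → Run b → ℕ
rlen (singleton x) = 0
rlen (ascending m k) = suc k
rlen (descending m k) = suc k

adjB-cases : ∀ x y → adjB x y ≡ true → (x ≡ suc y) ⊎ (y ≡ suc x)
adjB-cases x y e with x ≡ᵇ suc y in e1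
... | true = inj₁ (≡ᵇ⇒≡ x (suc y) (subst T (sym e1) _))
... | false = inj₂ (≡ᵇ⇒≡ y (suc x) (subst T (sym e) _))

upRun-head-∈ : ∀ m k → suc m ∈ upRun (suc m) k
upRun-head-∈ m zero = here refl
upRun-head-∈ m (suc k) = here refl

downRun-head-∈ : ∀ m k → k + m ∈ downRun m k
downRun-head-∈ m zero = here refl
downRun-head-∈ m (suc k) = here refl

Run-∷ : ∀ {x y b} → Run (y ∷ b) → adjB x y ≡ true → x ∉ b → Run (x ∷ y ∷ b)
Run-∷ {x} {y} (singleton .y) e nb with adjB-cases x y e
... | inj₁ refl = descending y 0
... | inj₂ refl = ascending x 0
Run-∷ {x} (ascending m k) e nb with adjB-cases x m e
... | inj₁ refl = ⊥-elim (nb (upRun-head-∈ m k))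
... | inj₂ refl = ascending x (suc k)
Run-∷ {x} (descending m k) e nb with adjB-cases x (suc (k + m)) e
... | inj₁ refl = descending m (suc k)
... | inj₂ refl = ⊥-elim (nb (downRun-head-∈ m k))

strips-concat-Run : ∀ xs → Unique xs → (concat (strips xs) ≡ xs) × All Run (strips xs)
strips-concat-Run [] u = refl , []
strips-concat-Run (x ∷ xs) (nx ∷ u) with strips xs | strips-concat-Run xs u
... | [] | refl , [] = refl , (singleton x ∷ [])
... | (y ∷ b) ∷ bs | e , (r ∷ rs) with adjB x y in ea
...   | true = cong (x ∷_) e , (Run-∷ r ea (λ m → All.lookup nx (subst (_ ∈_) e (there-b m)) refl) ∷ rs)
  where
  there-b : ∀ {z} → z ∈ b → z ∈ concat ((y ∷ b) ∷ bs)
  there-b m = there (∈-++⁺ˡ m)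
...   | false = cong (x ∷_) e , (singleton x ∷ r ∷ rs)
strips-concat-Run (x ∷ xs) (nx ∷ u) | [] ∷ bs | e , (() ∷ rs)

minL-upRun : ∀ m k → minL (upRun m k) ≡ m
minL-upRun m zero = refl
minL-upRun m (suc zero) = m≤n⇒m⊓n≡m (n≤1+n m)
minL-upRun m (suc (suc k)) = trans (cong (m ⊓_) (minL-upRun (suc m) (suc k))) (m≤n⇒m⊓n≡m (n≤1+n m))

minL-downRun : ∀ m k → minL (downRun m k) ≡ m
minL-downRun m zero = refl
minL-downRun m (suc zero) = m≥n⇒m⊓n≡n (n≤1+n m)
minL-downRun m (suc (suc k)) = trans (cong (suc (suc k + m) ⊓_) (minL-downRun m (suc k))) (m≥n⇒m⊓n≡n (m≤n⇒m≤1+n (m≤n+m m (suc k))))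

minL-Run : ∀ {b} (r : Run b) → minL b ≡ rmin r
minL-Run (singleton x) = refl
minL-Run (ascending m k) = minL-upRun m (suc k)
minL-Run (descending m k) = minL-downRun m (suc k)

∈-upRun : ∀ {y} m j → y ∈ upRun m j → (m ≤ y) × (y ≤ m + j)
∈-upRun m zero (here refl) = ≤-refl , ≤-reflexive (sym (+-identityʳ m))
∈-upRun m (suc j) (here refl) = ≤-refl , m≤m+n m (suc j)
∈-upRun {y} m (suc j) (there p) with ∈-upRun (suc m) j p
... | a , b = ≤-trans (n≤1+n m) a , subst (y ≤_) (sym (+-suc m j)) b

∈-downRun : ∀ {y} m j → y ∈ downRun m j → (m ≤ y) × (y ≤ m + j)
∈-downRun m zero (here refl) = ≤-refl , ≤-reflexive (sym (+-identityʳ m))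
∈-downRun m (suc j) (here refl) = m≤n⇒m≤1+n (m≤n+m m j) , ≤-reflexive (trans (cong suc (+-comm j m)) (sym (+-suc m j)))
∈-downRun m (suc j) (there p) with ∈-downRun m j p
... | a , b = a , ≤-trans b (+-monoʳ-≤ m (n≤1+n j))

∋-upRun : ∀ {y} m j → m ≤ y → y ≤ m + j → y ∈ upRun m j
∋-upRun {y} m zero a b = here (≤-antisym (subst (y ≤_) (+-identityʳ m) b) a)
∋-upRun {y} m (suc j) a b with m ≟ y
... | yes refl = here refl
... | no ne = there (∋-upRun (suc m) j (≤∧≢⇒< a ne) (subst (y ≤_) (+-suc m j) b))

∋-downRun : ∀ {y} m j → m ≤ y → y ≤ m + j → y ∈ downRun m j
∋-downRun {y} m zero a b = here (≤-antisym (subst (y ≤_) (+-identityʳ m) b) a)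
∋-downRun {y} m (suc j) a b with y ≟ suc (j + m)
... | yes refl = here refl
... | no ne = there (∋-downRun m j a (subst (y ≤_) (+-comm j m) (s≤s⁻¹ (≤∧≢⇒< b' ne))))
  where
  b' : y ≤ suc (j + m)
  b' = subst (y ≤_) (trans (+-suc m j) (cong suc (+-comm m j))) b

Run-∈ : ∀ {b y} (r : Run b) → y ∈ b → (rmin r ≤ y) × (y ≤ rmin r + rlen r)
Run-∈ (singleton x) (here refl) = ≤-refl , ≤-reflexive (sym (+-identityʳ x))
Run-∈ (ascending m k) p = ∈-upRun m (suc k) p
Run-∈ (descending m k) p = ∈-downRun m (suc k) p

Run-∋ : ∀ {b y} (r : Run b) → rmin r ≤ y → y ≤ rmin r + rlen r → y ∈ b
Run-∋ {y = y} (singleton x) a c = here (≤-antisym (subst (y ≤_) (+-identityʳ x) c) a)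
Run-∋ (ascending m k) a c = ∋-upRun m (suc k) a c
Run-∋ (descending m k) a c = ∋-downRun m (suc k) a c

rmin-∈ : ∀ {b} (r : Run b) → rmin r ∈ b
rmin-∈ r = Run-∋ r ≤-refl (m≤m+n _ _)

-- Runs are intervals of values, so disjoint runs compare entrywise like their minima.
Run-disjoint-order : ∀ {b c x y} (rb : Run b) (rc : Run c) → (∀ {z} → z ∈ b → z ∈ c → ⊥) → x ∈ b → y ∈ c →
  (rmin rc < rmin rb → y < x) × (¬ (rmin rc < rmin rb) → ¬ (y < x))
Run-disjoint-order {b} {c} {x} {y} rb rc disj xb yc = f , g
  where
  f : rmin rc < rmin rb → y < x
  f lt with y <? x
  ... | yes p = p
  ... | no p = ⊥-elim (disj (rmin-∈ rb)
          (Run-∋ rc (<⇒≤ lt) (≤-trans (proj₁ (Run-∈ rb xb)) (≤-trans (≮⇒≥ p) (proj₂ (Run-∈ rc yc))))))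
  g : ¬ (rmin rc < rmin rb) → ¬ (y < x)
  g nlt ylx = disj (Run-∋ rb (≮⇒≥ nlt) (≤-trans (proj₁ (Run-∈ rc yc)) (≤-trans (<⇒≤ ylx) (proj₂ (Run-∈ rb xb)))))
                   (rmin-∈ rc)

Unique-++⇒disjoint : ∀ {xs ys : List ℕ} {z} → Unique (xs ++ ys) → z ∈ xs → z ∈ ys → ⊥
Unique-++⇒disjoint {x ∷ xs} (x∉ ∷ u) (here refl) zy = All.lookup (AllP.++⁻ʳ xs x∉) zy refl
Unique-++⇒disjoint {x ∷ xs} (_ ∷ u) (there zx) zy = Unique-++⇒disjoint u zx zy

Unique-++⁻ʳ : ∀ (xs : List ℕ) {ys} → Unique (xs ++ ys) → Unique ys
Unique-++⁻ʳ [] u = u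
Unique-++⁻ʳ (x ∷ xs) (_ ∷ u) = Unique-++⁻ʳ xs u

rank-all< : ∀ {x} xs → All (_< x) xs → rank x xs ≡ length xs
rank-all< [] [] = refl
rank-all< (y ∷ ys) (p ∷ ps) = trans (rank-∷-< ys p) (cong suc (rank-all< ys ps))

rank-none : ∀ {x} xs → All (λ y → ¬ y < x) xs → rank x xs ≡ 0
rank-none [] [] = refl
rank-none (y ∷ ys) (p ∷ ps) = trans (rank-∷-≮ ys p) (rank-none ys ps)

rank-strict : ∀ {a a'} M → a ∈ M → a < a' → rank a M < rank a' M
rank-strict (y ∷ M) (here refl) lt =
  subst₂ _<_ (sym (rank-∷-≮ M (<-irrefl refl))) (sym (rank-∷-< M lt)) (s≤s (rank-mono (<⇒≤ lt) M))
rank-strict {a} {a'} (y ∷ M) (there m) lt with y <? a | y <? a'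
... | yes p | yes q = subst₂ _<_ (sym (rank-∷-< M p)) (sym (rank-∷-< M q)) (s≤s (rank-strict M m lt))
... | yes p | no q = ⊥-elim (q (<-trans p lt))
... | no p | yes q = subst₂ _<_ (sym (rank-∷-≮ M p)) (sym (rank-∷-< M q)) (m≤n⇒m≤1+n (rank-strict M m lt))
... | no p | no q = subst₂ _<_ (sym (rank-∷-≮ M p)) (sym (rank-∷-≮ M q)) (rank-strict M m lt)

rank-concat : ∀ x (Bs : List (List ℕ)) → rank x (concat Bs) ≡ sum (map (rank x) Bs)
rank-concat x [] = refl
rank-concat x (c ∷ Bs) = trans (rank-++ x c (concat Bs)) (cong (rank x c +_) (rank-concat x Bs))

take2 : List ℕ → List ℕ
take2 = take 2

-- Keeping the first one or two entries of every strip of γ gives a copy of min(peg γ) inside γ.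
pick : List (List ℕ) → List ℕ
pick B = concatMap take2 B

take2-∈ : ∀ {y} c → y ∈ take2 c → y ∈ c
take2-∈ (a ∷ c) (here p) = here p
take2-∈ (a ∷ b ∷ c) (there (here p)) = there (here p)

sizeD-if : ∀ b → sizeD (if b then plus else minus) ≡ 2
sizeD-if true = refl
sizeD-if false = refl

length-take2 : ∀ {c} → Run c → length (take2 c) ≡ sizeD (decoOf c)
length-take2 (singleton x) = refl
length-take2 (ascending m zero) = sym (sizeD-if _)
length-take2 (ascending m (suc k)) = sym (sizeD-if _)
length-take2 (descending m zero) = sym (sizeD-if _)
length-take2 (descending m (suc k)) = sym (sizeD-if _)

pick-⊆ : ∀ B → pick B ⊆ concat B
pick-⊆ [] = []
pick-⊆ (c ∷ B) = SubH.++⁺ (t2 c) (pick-⊆ B)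
  where
  t2 : ∀ c → take2 c ⊆ c
  t2 [] = []
  t2 (a ∷ []) = refl ∷ []
  t2 (a ∷ b ∷ c) = refl ∷ (refl ∷ minimum c)

sizeBelow : ℕ → ℕ × Deco → ℕ
sizeBelow v e with proj₁ e <? v
... | yes _ = sizeD (proj₂ e)
... | no _ = 0

base-sum : ∀ v P → base v P ≡ sum (map (sizeBelow v) P)
base-sum v [] = refl
base-sum v (e ∷ P) with proj₁ e <? v in eq
... | yes p = trans (cong (λ l → sum (map (λ e' → sizeD (proj₂ e')) l)) (filter-accept (λ e' → proj₁ e' <? v) p)) (cong (sizeD (proj₂ e) +_) (base-sum v P))
... | no p = trans (cong (λ l → sum (map (λ e' → sizeD (proj₂ e')) l)) (filter-reject (λ e' → proj₁ e' <? v) p)) (base-sum v P)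

sum-map-++ : ∀ (f : List ℕ → ℕ) B1 b B2 → sum (map f (B1 ++ b ∷ B2)) ≡ sum (map f B1) + (f b + sum (map f B2))
sum-map-++ f B1 b B2 = trans (cong sum (map-++ f B1 (b ∷ B2))) (sum-++ (map f B1) (f b ∷ map f B2))

sizeBelow-< : ∀ {w} e → proj₁ e < w → sizeBelow w e ≡ sizeD (proj₂ e)
sizeBelow-< {w} e p with proj₁ e <? w
... | yes _ = refl
... | no q = ⊥-elim (q p)

sizeBelow-≮ : ∀ {w} e → ¬ (proj₁ e < w) → sizeBelow w e ≡ 0
sizeBelow-≮ {w} e p with proj₁ e <? w
... | yes q = ⊥-elim (p q)
... | no _ = refl

≡ᵇ-+2 : ∀ n → (n ≡ᵇ suc (suc n)) ≡ false
≡ᵇ-+2 zero = refl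
≡ᵇ-+2 (suc n) = ≡ᵇ-+2 n

block-ascending : ∀ β m rest → map (λ x → suc (β + rank x (m ∷ suc m ∷ []))) (m ∷ suc m ∷ []) ≡ block β (decoOf (m ∷ suc m ∷ rest))
block-ascending β m rest rewrite ≡ᵇ-refl m
  | rank-∷-≮ {m} {m} (suc m ∷ []) (<-irrefl refl) | rank-∷-≮ {m} {suc m} [] (λ q → <-irrefl refl (≤-trans (n≤1+n (suc m)) q))
  | rank-∷-< {suc m} {m} (suc m ∷ []) ≤-refl | rank-∷-≮ {suc m} {suc m} [] (<-irrefl refl)
  = cong₂ (λ a b → suc a ∷ suc b ∷ []) (+-identityʳ β) (trans (+-suc β 0) (cong suc (+-identityʳ β)))

block-descending : ∀ β a rest → map (λ x → suc (β + rank x (suc a ∷ a ∷ []))) (suc a ∷ a ∷ []) ≡ block β (decoOf (suc a ∷ a ∷ rest))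
block-descending β a rest rewrite ≡ᵇ-+2 a
  | rank-∷-≮ {suc a} {suc a} (a ∷ []) (<-irrefl refl) | rank-∷-< {suc a} {a} [] ≤-refl
  | rank-∷-≮ {a} {suc a} (a ∷ []) (λ q → <-irrefl refl (≤-trans (n≤1+n (suc a)) q)) | rank-∷-≮ {a} {a} [] (<-irrefl refl)
  = cong₂ (λ a b → suc a ∷ suc b ∷ []) (trans (+-suc β 0) (cong suc (+-identityʳ β))) (+-identityʳ β)

block-Run : ∀ {b} → Run b → ∀ β → map (λ x → suc (β + rank x (take2 b))) (take2 b) ≡ block β (decoOf b)
block-Run (singleton x) β rewrite rank-∷-≮ {x} {x} [] (<-irrefl refl) = cong (λ z → suc z ∷ []) (+-identityʳ β)
block-Run (ascending m zero) β = block-ascending β m []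
block-Run (ascending m (suc k)) β = block-ascending β m (upRun (suc (suc m)) k)
block-Run (descending m zero) β = block-descending β m []
block-Run (descending m (suc k)) β = block-descending β (suc (k + m)) (downRun m k)

concatMap-cong-local : ∀ {A B : Set} {f g : A → List B} {xs} → All (λ x → f x ≡ g x) xs → concatMap f xs ≡ concatMap g xs
concatMap-cong-local [] = refl
concatMap-cong-local {xs = x ∷ xs} (p ∷ ps) = cong₂ _++_ p (concatMap-cong-local ps)

module PickStandardization (B : List (List ℕ)) (rs : All Run B) (u : Unique (concat B)) where
  minima : List ℕ
  minima = map minL B

  value : List ℕ → ℕ
  value c = suc (rank (minL c) minima)

  entry : List ℕ → ℕ × Deco
  entry c = (value c , decoOf c)

  pegOfStrips : Peg
  pegOfStrips = map entry B

  minL∈ : ∀ {c} → c ∈ B → minL c ∈ minima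
  minL∈ = ∈-map⁺ minL

  v⇒min : ∀ {b c} → value c < value b → minL c < minL b
  v⇒min {b} {c} lt with minL c <? minL b
  ... | yes p = p
  ... | no p = ⊥-elim (<-irrefl refl (≤-trans lt (s≤s (rank-mono (≮⇒≥ p) minima))))

  min⇒v : ∀ {b c} → c ∈ B → minL c < minL b → value c < value b
  min⇒v cB lt = s≤s (rank-strict minima (minL∈ cB) lt)

  rank-take2-disjointStrip : ∀ {b c x} → b ∈ B → c ∈ B → (∀ {z} → z ∈ b → z ∈ c → ⊥) → x ∈ b → rank x (take2 c) ≡ sizeBelow (value b) (entry c)
  rank-take2-disjointStrip {b} {c} {x} bB cB disj xb = go (value c <? value b)
   where
   rb = All.lookup rs bB
   rc = All.lookup rs cB
   go : Dec (value c < value b) → rank x (take2 c) ≡ sizeBelow (value b) (entry c)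
   go (yes p) = trans (rank-all< (take2 c) (All.tabulate (λ m → proj₁ (Run-disjoint-order rb rc disj xb (take2-∈ c m)) mlt)))
                  (trans (length-take2 rc) (sym (sizeBelow-< (entry c) p)))
    where
    mlt : rmin rc < rmin rb
    mlt = subst₂ _<_ (minL-Run rc) (minL-Run rb) (v⇒min {b} {c} p)
   go (no p) = trans (rank-none (take2 c) (All.tabulate (λ m → proj₂ (Run-disjoint-order rb rc disj xb (take2-∈ c m)) nlt)))
                 (sym (sizeBelow-≮ (entry c) p))
    where
    nlt : ¬ (rmin rc < rmin rb)
    nlt q = p (min⇒v {b} {c} cB (subst₂ _<_ (sym (minL-Run rc)) (sym (minL-Run rb)) q))

  rank-pick : ∀ {b x} → b ∈ B → x ∈ take2 b → rank x (pick B) ≡ base (value b) pegOfStrips + rank x (take2 b)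
  rank-pick {b} {x} bB xt with ∈-∃++ bB
  ... | B1 , B2 , eq = begin
      rank x (pick B)
    ≡⟨ trans (rank-concat x (map take2 B)) (cong sum (sym (map-∘ B))) ⟩
      sum (map f B)
    ≡⟨ cong (λ Bs → sum (map f Bs)) eq ⟩
      sum (map f (B1 ++ b ∷ B2))
    ≡⟨ sum-map-++ f B1 b B2 ⟩
      sum (map f B1) + (f b + sum (map f B2))
    ≡⟨ cong₂ (λ p q → p + (f b + q)) (map-eq B1 (λ c∈ → inB1 c∈) (λ c∈ zb zc → disj1 c∈ zb zc)) (map-eq B2 (λ c∈ → inB2 c∈) (λ c∈ zb zc → disj2 c∈ zb zc)) ⟩
      sum (map g B1) + (f b + sum (map g B2))
    ≡⟨ trans (cong (sum (map g B1) +_) (+-comm (f b) (sum (map g B2)))) (sym (+-assoc (sum (map g B1)) (sum (map g B2)) (f b))) ⟩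
      (sum (map g B1) + (0 + sum (map g B2))) + f b
    ≡⟨ cong (λ z → (sum (map g B1) + (z + sum (map g B2))) + f b) (sym (sizeBelow-≮ (entry b) (<-irrefl refl))) ⟩
      (sum (map g B1) + (g b + sum (map g B2))) + f b
    ≡⟨ cong (_+ f b) (sym (sum-map-++ g B1 b B2)) ⟩
      sum (map g (B1 ++ b ∷ B2)) + f b
    ≡⟨ cong (λ Bs → sum (map g Bs) + f b) (sym eq) ⟩
      sum (map g B) + f b
    ≡⟨ cong (_+ f b) (sym (trans (base-sum (value b) pegOfStrips) (cong sum (sym (map-∘ B))))) ⟩
      base (value b) pegOfStrips + rank x (take2 b)
    ∎
    where
    open ≡-Reasoning
    f : List ℕ → ℕ
    f c = rank x (take2 c)
    g : List ℕ → ℕ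
    g c = sizeBelow (value b) (entry c)
    xb : x ∈ b
    xb = take2-∈ b xt
    u' : Unique (concat B1 ++ (b ++ concat B2))
    u' = subst Unique (trans (cong concat eq) (sym (concat-++ B1 (b ∷ B2)))) u
    inB1 : ∀ {c} → c ∈ B1 → c ∈ B
    inB1 m = subst (_ ∈_) (sym eq) (∈-++⁺ˡ m)
    inB2 : ∀ {c} → c ∈ B2 → c ∈ B
    inB2 m = subst (_ ∈_) (sym eq) (∈-++⁺ʳ B1 (there m))
    disj1 : ∀ {c z} → c ∈ B1 → z ∈ b → z ∈ c → ⊥
    disj1 cm zb zc = Unique-++⇒disjoint u' (∈-concat⁺′ zc cm) (∈-++⁺ˡ zb)
    disj2 : ∀ {c z} → c ∈ B2 → z ∈ b → z ∈ c → ⊥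
    disj2 cm zb zc = Unique-++⇒disjoint (Unique-++⁻ʳ (concat B1) u') zb (∈-concat⁺′ zc cm)
    map-eq : ∀ Bs → (∀ {c} → c ∈ Bs → c ∈ B) → (∀ {c z} → c ∈ Bs → z ∈ b → z ∈ c → ⊥) → sum (map f Bs) ≡ sum (map g Bs)
    map-eq Bs inB dj = cong sum (map-cong-local (All.tabulate (λ {c} cm → rank-take2-disjointStrip bB (inB cm) (λ zb zc → dj cm zb zc) xb)))

  std-pick-strip : ∀ {b} → b ∈ B → map (λ x → suc (rank x (pick B))) (take2 b) ≡ block (base (value b) pegOfStrips) (decoOf b)
  std-pick-strip {b} bB = trans (map-cong-local (All.tabulate (λ xt → cong suc (rank-pick bB xt)))) (block-Run (All.lookup rs bB) (base (value b) pegOfStrips))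

  std-pick : std (pick B) ≡ minPeg pegOfStrips
  std-pick = trans (map-concatMap (λ x → suc (rank x (pick B))) take2 B)
    (trans (concatMap-cong-local (All.tabulate std-pick-strip))
      (sym (concatMap-map (λ e → block (base (proj₁ e) pegOfStrips) (proj₂ e)) entry B)))

zip-map-map : ∀ {A B C : Set} (f : A → B) (g : A → C) xs → zip (map f xs) (map g xs) ≡ map (λ x → (f x , g x)) xs
zip-map-map f g [] = refl
zip-map-map f g (x ∷ xs) = cong ((f x , g x) ∷_) (zip-map-map f g xs)

peg-strips : ∀ γ → peg γ ≡ map (λ c → (suc (rank (minL c) (map minL (strips γ))) , decoOf c)) (strips γ)
peg-strips γ = trans (cong (λ l → zip l (map decoOf B)) (sym (map-∘ B))) (zip-map-map _ decoOf B)
  where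
  B = strips γ

pick-⊆×std : ∀ γ → IsPerm γ → (pick (strips γ) ⊆ γ) × (std (pick (strips γ)) ≡ minPeg (peg γ))
pick-⊆×std γ p with strips-concat-Run γ (IsPerm⇒Unique γ p)
... | e , rs = subst (pick (strips γ) ⊆_) e (pick-⊆ (strips γ)) ,
  trans (PickStandardization.std-pick (strips γ) rs (subst Unique (sym e) (IsPerm⇒Unique γ p))) (cong minPeg (sym (peg-strips γ)))

minPeg-peg-≼ : ∀ γ → IsPerm γ → minPeg (peg γ) ≼ γ
minPeg-peg-≼ γ p = pick (strips γ) , proj₁ (pick-⊆×std γ p) , proj₂ (pick-⊆×std γ p)

lastL : ℕ → List ℕ → ℕ
lastL x [] = x
lastL x (y ∷ ys) = lastL y ys

lastL-∷ʳ : ∀ x ys z → lastL x (ys ++ [ z ]) ≡ z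
lastL-∷ʳ x [] z = refl
lastL-∷ʳ x (y ∷ ys) z = lastL-∷ʳ y ys z

strips-∷-head : ∀ y ys → Σ (List ℕ) λ b → Σ (List (List ℕ)) λ bs → strips (y ∷ ys) ≡ (y ∷ b) ∷ bs
strips-∷-head y ys with strips ys
... | [] = [] , [] , refl
... | [] ∷ bs = [] , [] ∷ bs , refl
... | (z ∷ b) ∷ bs with adjB y z
...   | true = z ∷ b , bs , refl
...   | false = [] , (z ∷ b) ∷ bs , refl

strips-∷-nonadjacent : ∀ x y ys → adjB x y ≡ false → strips (x ∷ y ∷ ys) ≡ [ x ] ∷ strips (y ∷ ys)
strips-∷-nonadjacent x y ys e with strips-∷-head y ys
... | b , bs , eq = byHead (strips (y ∷ ys)) eq
  where
  byHead : ∀ S → S ≡ (y ∷ b) ∷ bs → strips (x ∷ y ∷ ys) ≡ [ x ] ∷ S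
  byHead S refl rewrite eq | e = refl

strips-∷-∷ʳ-nonadjacent : ∀ x xs z → adjB (lastL x xs) z ≡ false → strips ((x ∷ xs) ++ [ z ]) ≡ strips (x ∷ xs) ++ [ [ z ] ]
strips-∷-∷ʳ-nonadjacent x [] z e rewrite e = refl
strips-∷-∷ʳ-nonadjacent x (x' ∷ xs) z e with strips-∷-head x' xs
... | b , bs , eq rewrite strips-∷-∷ʳ-nonadjacent x' xs z e | eq with adjB x x'
...   | true = refl
...   | false = refl

strips-map-suc : ∀ xs → strips (map suc xs) ≡ map (map suc) (strips xs)
strips-map-suc [] = refl
strips-map-suc (x ∷ xs) rewrite strips-map-suc xs with strips xs
... | [] = refl
... | [] ∷ bs = refl
... | (y ∷ b) ∷ bs with adjB x y
...   | true = refl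
...   | false = refl

std-∷-∷ʳ : ∀ a c M → All (_< c) M → c < a → std (a ∷ (M ++ [ c ])) ≡ suc (suc (length M)) ∷ (std M ++ [ suc (length M) ])
std-∷-∷ʳ a c M allc c<a = cong₂ _∷_ headEq (trans (map-++ _ M [ c ]) (cong₂ _++_ midEq lastEq))
  where
  whole = a ∷ (M ++ [ c ])
  a<a : ¬ a < a
  a<a = <-irrefl refl
  allA : All (_< a) M
  allA = All.map (λ p → <-trans p c<a) allc
  headEq : suc (rank a whole) ≡ suc (suc (length M))
  headEq = cong suc (trans (rank-∷-≮ {a} (M ++ [ c ]) a<a) (trans (rank-++ a M [ c ])
             (trans (cong₂ _+_ (rank-all< M allA) (trans (rank-∷-< {a} [] c<a) refl)) (+-comm (length M) 1))))
  midEq : map (λ x → suc (rank x whole)) M ≡ std M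
  midEq = map-cong-local (All.map (λ {y} y<c → cong suc
            (trans (rank-∷-≮ {y} (M ++ [ c ]) (λ q → <-irrefl refl (<-trans q (<-trans y<c c<a))))
            (trans (rank-++ y M [ c ]) (trans (cong (rank y M +_) (rank-∷-≮ {y} [] (λ q → <-irrefl refl (<-trans q y<c)))) (+-identityʳ _))))) allc)
  lastEq : map (λ x → suc (rank x whole)) [ c ] ≡ [ suc (length M) ]
  lastEq = cong (λ z → suc z ∷ []) (trans (rank-∷-≮ {c} (M ++ [ c ]) (λ q → <-irrefl refl (<-trans q c<a)))
             (trans (rank-++ c M [ c ]) (trans (cong₂ _+_ (rank-all< M allc) (rank-∷-≮ {c} [] (<-irrefl refl))) (+-identityʳ _))))

rank-map-suc : ∀ y M → rank (suc y) (map suc M) ≡ rank y M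
rank-map-suc y [] = refl
rank-map-suc y (z ∷ M) with z <? y
... | yes p = trans (rank-∷-< (map suc M) (s≤s p)) (trans (cong suc (rank-map-suc y M)) (sym (rank-∷-< M p)))
... | no p = trans (rank-∷-≮ (map suc M) (λ { (s≤s q) → p q })) (trans (rank-map-suc y M) (sym (rank-∷-≮ M p)))

std-map-suc-++ : ∀ a M → All (1 ≤_) M → All (λ y → suc y < a) M → 1 < a →
  std (map suc M ++ (a ∷ 1 ∷ [])) ≡ map suc (std M) ++ (suc (suc (length M)) ∷ 1 ∷ [])
std-map-suc-++ a M lo hi 1<a = trans (map-++ _ (map suc M) (a ∷ 1 ∷ [])) (cong₂ _++_ midEq (cong₂ _∷_ aEq (cong (_∷ []) oneEq)))
  where
  whole = map suc M ++ (a ∷ 1 ∷ [])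
  midEq : map (λ x → suc (rank x whole)) (map suc M) ≡ map suc (std M)
  midEq = trans (sym (map-∘ M)) (trans (map-cong-local (All.zipWith shiftedRank (lo , hi))) (map-∘ M))
    where
    shiftedRank : ∀ {y} → (1 ≤ y) × (suc y < a) → suc (rank (suc y) whole) ≡ suc (suc (rank y M))
    shiftedRank {y} (1≤y , sy<a) = cong suc (begin
      rank (suc y) (map suc M ++ (a ∷ 1 ∷ []))             ≡⟨ rank-++ (suc y) (map suc M) (a ∷ 1 ∷ []) ⟩
      rank (suc y) (map suc M) + rank (suc y) (a ∷ 1 ∷ []) ≡⟨ cong₂ _+_ (rank-map-suc y M)
                                                               (trans (rank-∷-≮ {suc y} (1 ∷ []) (λ q → <-irrefl refl (<-trans q sy<a))) (rank-∷-< {suc y} [] (s≤s 1≤y))) ⟩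
      rank y M + 1                                         ≡⟨ +-comm (rank y M) 1 ⟩
      suc (rank y M)                                       ∎)
      where open ≡-Reasoning
  aEq : suc (rank a whole) ≡ suc (suc (length M))
  aEq = cong suc (trans (rank-++ a (map suc M) (a ∷ 1 ∷ []))
          (trans (cong₂ _+_ (trans (rank-all< (map suc M) (allmap hi)) (length-map suc M))
                           (trans (rank-∷-≮ {a} (1 ∷ []) (<-irrefl refl)) (trans (rank-∷-< {a} [] 1<a) refl)))
          (+-comm (length M) 1)))
    where
    allmap : ∀ {M} → All (λ y → suc y < a) M → All (_< a) (map suc M)
    allmap [] = []
    allmap (p ∷ ps) = p ∷ allmap ps
  oneEq : suc (rank 1 whole) ≡ 1
  oneEq = cong suc (trans (rank-++ 1 (map suc M) (a ∷ 1 ∷ []))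
            (trans (cong₂ _+_ (rank-none (map suc M) (allmap lo)) (trans (rank-∷-≮ {1} (1 ∷ []) (λ q → <-irrefl refl (<-trans q 1<a))) (rank-∷-≮ {1} [] (<-irrefl refl)))) refl))
    where
    allmap : ∀ {M} → All (1 ≤_) M → All (λ y → ¬ y < 1) (map suc M)
    allmap [] = []
    allmap (p ∷ ps) = (λ { (s≤s ()) }) ∷ allmap ps

strips-∷ʳ-nonadjacent : ∀ ys z d → adjB (lastL d ys) z ≡ false → strips (ys ++ [ z ]) ≡ strips ys ++ [ [ z ] ]
strips-∷ʳ-nonadjacent [] z d e = refl
strips-∷ʳ-nonadjacent (x ∷ xs) z d e = strips-∷-∷ʳ-nonadjacent x xs z e

All-minL-strips : ∀ {P : ℕ → Set} xs → Unique xs → All P xs → All P (map minL (strips xs))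
All-minL-strips {P} xs u a with strips-concat-Run xs u
... | e , rs = AllP.map⁺ (All.tabulate (λ {b} bm → subst P (sym (minL-Run (All.lookup rs bm)))
                 (All.lookup a (subst (rmin (All.lookup rs bm) ∈_) e (∈-concat⁺′ (rmin-∈ (All.lookup rs bm)) bm)))))

length-peg : ∀ γ → length (peg γ) ≡ length (strips γ)
length-peg γ = trans (cong length (peg-strips γ)) (length-map _ (strips γ))

zip-∷-∷ʳ : ∀ {A B : Set} x (X : List A) y d (D : List B) e → length X ≡ length D → zip (x ∷ (X ++ [ y ])) (d ∷ (D ++ [ e ])) ≡ (x , d) ∷ (zip X D ++ [ (y , e) ])
zip-∷-∷ʳ x [] y d [] e _ = refl
zip-∷-∷ʳ x (x' ∷ X) y d (d' ∷ D) e l = cong ((x , d) ∷_) (zip-∷-∷ʳ x' X y d' D e (cong pred l))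

zip-map-++ : ∀ {A B : Set} (f : A → A) (g : A × B → A × B) → (∀ a b → g (a , b) ≡ (f a , b)) → ∀ (X : List A) (D : List B) y1 y2 e1 e2 → length X ≡ length D →
  zip (map f X ++ (y1 ∷ y2 ∷ [])) (D ++ (e1 ∷ e2 ∷ [])) ≡ map g (zip X D) ++ ((y1 , e1) ∷ (y2 , e2) ∷ [])
zip-map-++ f g gf [] [] y1 y2 e1 e2 _ = refl
zip-map-++ f g gf (x ∷ X) (d ∷ D) y1 y2 e1 e2 l = cong₂ _∷_ (sym (gf x d)) (zip-map-++ f g gf X D y1 y2 e1 e2 (cong pred l))

-- The permutations min(Θ) = N (N-2) (N-4) … (N-3) (N-1)

thetaPerm : ℕ → List ℕ
thetaPerm zero = []
thetaPerm (suc N) = suc N ∷ reverse (thetaPerm N)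

thetaSortingSeq : ℕ → List ℕ
thetaSortingSeq zero = []
thetaSortingSeq (suc zero) = []
thetaSortingSeq (suc (suc N)) = suc (suc N) ∷ thetaSortingSeq (suc N)

length-thetaPerm : ∀ N → length (thetaPerm N) ≡ N
length-thetaPerm zero = refl
length-thetaPerm (suc N) = cong suc (trans (length-reverse (thetaPerm N)) (length-thetaPerm N))

length-thetaSortingSeq : ∀ N → length (thetaSortingSeq N) ≡ N ∸ 1
length-thetaSortingSeq zero = refl
length-thetaSortingSeq (suc zero) = refl
length-thetaSortingSeq (suc (suc N)) = cong suc (length-thetaSortingSeq (suc N))

thetaSortingSeq-≤ : ∀ N → All (_≤ length (thetaPerm N)) (thetaSortingSeq N)
thetaSortingSeq-≤ N = subst (λ m → All (_≤ m) (thetaSortingSeq N)) (sym (length-thetaPerm N)) (bounded N)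
  where
  bounded : ∀ N → All (_≤ N) (thetaSortingSeq N)
  bounded zero = []
  bounded (suc zero) = []
  bounded (suc (suc N)) = ≤-refl ∷ All.map m≤n⇒m≤1+n (bounded (suc N))

reverse-thetaPerm : ∀ N → reverse (thetaPerm (suc N)) ≡ thetaPerm N ++ [ suc N ]
reverse-thetaPerm N = trans (unfold-reverse (suc N) (reverse (thetaPerm N))) (cong (_++ [ suc N ]) (reverse-involutive (thetaPerm N)))

thetaPerm-suc-suc : ∀ N → thetaPerm (suc (suc N)) ≡ suc (suc N) ∷ (thetaPerm N ++ [ suc N ])
thetaPerm-suc-suc N = cong (suc (suc N) ∷_) (reverse-thetaPerm N)

applyRevs-thetaSortingSeq : ∀ N → applyRevs (thetaSortingSeq N) (thetaPerm N) ≡ idPerm N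
applyRevs-thetaSortingSeq zero = refl
applyRevs-thetaSortingSeq (suc zero) = refl
applyRevs-thetaSortingSeq (suc (suc N)) = begin
  applyRevs (thetaSortingSeq (suc N)) (prefRev (suc (suc N)) (thetaPerm (suc (suc N))))
    ≡⟨ cong (applyRevs (thetaSortingSeq (suc N)))
         (trans (prefRev-whole (thetaPerm (suc (suc N))) (length-thetaPerm (suc (suc N)))) (reverse-thetaPerm (suc N))) ⟩
  applyRevs (thetaSortingSeq (suc N)) (thetaPerm (suc N) ++ [ suc (suc N) ])
    ≡⟨ applyRevs-++ (thetaSortingSeq (suc N)) (thetaPerm (suc N)) [ suc (suc N) ] (thetaSortingSeq-≤ (suc N)) ⟩
  applyRevs (thetaSortingSeq (suc N)) (thetaPerm (suc N)) ++ [ suc (suc N) ]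
    ≡⟨ cong (_++ [ suc (suc N) ]) (applyRevs-thetaSortingSeq (suc N)) ⟩
  idPerm (suc N) ++ [ suc (suc N) ]
    ≡⟨ sym (idPerm-∷ʳ (suc N)) ⟩
  idPerm (suc (suc N)) ∎
  where open ≡-Reasoning

thetaPerm-↭ : ∀ N → thetaPerm N ↭ idPerm N
thetaPerm-↭ N = ↭-trans (↭-sym (applyRevs-↭ (thetaSortingSeq N) (thetaPerm N))) (↭-reflexive (applyRevs-thetaSortingSeq N))

thetaPerm-IsPerm : ∀ N → IsPerm (thetaPerm N)
thetaPerm-IsPerm N = subst (λ m → thetaPerm N ↭ idPerm m) (sym (length-thetaPerm N)) (thetaPerm-↭ N)

thetaPerm-≤ : ∀ N → All (_≤ N) (thetaPerm N)
thetaPerm-≤ N = ↭idPerm-upper N (thetaPerm-↭ N)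

thetaPerm-ChainSortable : ∀ N → ChainSortable _≤_ (N ∸ 1) (thetaPerm N)
thetaPerm-ChainSortable N = ChainSortable-by (thetaSortingSeq N) (idPerm N) (applyRevs-thetaSortingSeq N) (idPerm-sorted N)
  (≤-reflexive (length-thetaSortingSeq N)) (thetaSortingSeq-≤ N)

-- A proper pattern either misses the leading maximum, or one full reversal puts that maximum last
-- and leaves a proper pattern of thetaPerm (N - 1) in front.
⊂thetaPerm-ChainSortable : ∀ N s → s ⊆ thetaPerm N → length s < N → ChainSortable _≤_ (N ∸ 2) s
⊂thetaPerm-ChainSortable (suc N) [] p lt = ChainSortable-short [] z≤n
⊂thetaPerm-ChainSortable (suc N) (x ∷ []) p lt = ChainSortable-short (x ∷ []) ≤-refl
⊂thetaPerm-ChainSortable (suc (suc M)) (x ∷ y ∷ s) (._ ∷ʳ p) lt =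
  ChainSortable-⊆ (subst ((x ∷ y ∷ s) ⊆_) (reverse-thetaPerm M) p)
    (ChainSortable-weaken (m∸n≤m M 1) (ChainSortable-∷ʳ (All.map m≤n⇒m≤1+n (thetaPerm-≤ M)) (thetaPerm-ChainSortable M)))
⊂thetaPerm-ChainSortable (suc (suc (suc M))) (x ∷ y ∷ s) (refl ∷ p) (s≤s lt) =
  ChainSortable-reverse (subst (ChainSortable _≤_ M) (sym (unfold-reverse x (y ∷ s)))
    (ChainSortable-∷ʳ (SubP.All-resp-⊆ p' (All.map m≤n⇒m≤1+n (thetaPerm-≤ (suc (suc M)))))
      (⊂thetaPerm-ChainSortable (suc (suc M)) (reverse (y ∷ s)) p' (subst (_< suc (suc M)) (sym (length-reverse (y ∷ s))) lt))))
  where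
  p' : reverse (y ∷ s) ⊆ thetaPerm (suc (suc M))
  p' = subst (reverse (y ∷ s) ⊆_) (reverse-involutive (thetaPerm (suc (suc M)))) (SubH.reverse⁺ p)
⊂thetaPerm-ChainSortable (suc (suc zero)) (x ∷ y ∷ s) (refl ∷ p) (s≤s (s≤s ()))

adjB-suc-suc : ∀ a → adjB (suc (suc a)) a ≡ false
adjB-suc-suc zero = refl
adjB-suc-suc (suc a) = adjB-suc-suc a

adjB-+2 : ∀ a → adjB a (suc (suc a)) ≡ false
adjB-+2 a = trans (adjB-sym (suc (suc a)) a) (adjB-suc-suc a)

adjacencies-thetaPerm : ∀ N → adjacencies adjB (thetaPerm (suc N) ++ [ suc (suc N) ]) ≡ 1
adjacencies-thetaPerm zero = refl
adjacencies-thetaPerm (suc zero) = refl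
adjacencies-thetaPerm (suc (suc K)) = begin
  adjacencies adjB (thetaPerm (suc (suc (suc K))) ++ [ suc (suc (suc (suc K))) ])
    ≡⟨ cong (λ l → adjacencies adjB (l ++ [ suc (suc (suc (suc K))) ])) (thetaPerm-suc-suc (suc K)) ⟩
  indicator (adjB (suc (suc (suc K))) (suc K)) + adjacencies adjB ((thetaPerm (suc K) ++ [ suc (suc K) ]) ++ [ suc (suc (suc (suc K))) ])
    ≡⟨ cong (λ b → indicator b + adjacencies adjB ((thetaPerm (suc K) ++ [ suc (suc K) ]) ++ [ suc (suc (suc (suc K))) ])) (adjB-suc-suc (suc K)) ⟩
  adjacencies adjB ((thetaPerm (suc K) ++ [ suc (suc K) ]) ++ [ suc (suc (suc (suc K))) ])
    ≡⟨ adjacencies-∷ʳ adjB (thetaPerm (suc K)) (suc (suc K)) (suc (suc (suc (suc K)))) ⟩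
  adjacencies adjB (thetaPerm (suc K) ++ [ suc (suc K) ]) + indicator (adjB (suc (suc K)) (suc (suc (suc (suc K)))))
    ≡⟨ cong (λ b → adjacencies adjB (thetaPerm (suc K) ++ [ suc (suc K) ]) + indicator b) (adjB-+2 (suc (suc K))) ⟩
  adjacencies adjB (thetaPerm (suc K) ++ [ suc (suc K) ]) + 0
    ≡⟨ trans (+-identityʳ _) (adjacencies-thetaPerm K) ⟩
  1 ∎
  where open ≡-Reasoning

lambdaPerm : ℕ → List ℕ
lambdaPerm zero = []
lambdaPerm (suc zero) = [ 1 ]
lambdaPerm (suc (suc N)) = map suc (lambdaPerm N) ++ (suc (suc N) ∷ 1 ∷ [])

-- lambdaReversingSeq N = 2, 3, …, N - 1
lambdaReversingSeq : ℕ → List ℕ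
lambdaReversingSeq zero = []
lambdaReversingSeq (suc zero) = []
lambdaReversingSeq (suc (suc zero)) = []
lambdaReversingSeq (suc (suc (suc zero))) = [ 2 ]
lambdaReversingSeq (suc (suc (suc (suc N)))) = lambdaReversingSeq (suc (suc N)) ++ (suc (suc N) ∷ suc (suc (suc N)) ∷ [])

length-lambdaPerm : ∀ N → length (lambdaPerm N) ≡ N
length-lambdaPerm zero = refl
length-lambdaPerm (suc zero) = refl
length-lambdaPerm (suc (suc N)) =
  trans (length-++-comm (map suc (lambdaPerm N)) (suc (suc N) ∷ 1 ∷ [])) (cong (λ m → suc (suc m)) (trans (length-map suc (lambdaPerm N)) (length-lambdaPerm N)))

length-lambdaReversingSeq : ∀ N → length (lambdaReversingSeq N) ≡ N ∸ 2
length-lambdaReversingSeq zero = refl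
length-lambdaReversingSeq (suc zero) = refl
length-lambdaReversingSeq (suc (suc zero)) = refl
length-lambdaReversingSeq (suc (suc (suc zero))) = refl
length-lambdaReversingSeq (suc (suc (suc (suc N)))) =
  trans (length-++-comm (lambdaReversingSeq (suc (suc N))) (suc (suc N) ∷ suc (suc (suc N)) ∷ [])) (cong (λ m → suc (suc m)) (length-lambdaReversingSeq (suc (suc N))))

lambdaReversingSeq-≤ : ∀ N → All (_≤ length (lambdaPerm N)) (lambdaReversingSeq N)
lambdaReversingSeq-≤ N = subst (λ m → All (_≤ m) (lambdaReversingSeq N)) (sym (length-lambdaPerm N)) (bounded N)
  where
  bounded : ∀ N → All (_≤ N) (lambdaReversingSeq N)
  bounded zero = []
  bounded (suc zero) = []
  bounded (suc (suc zero)) = []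
  bounded (suc (suc (suc zero))) = s≤s (s≤s z≤n) ∷ []
  bounded (suc (suc (suc (suc N)))) =
    AllP.++⁺ (All.map (λ p → m≤n⇒m≤1+n (m≤n⇒m≤1+n p)) (bounded (suc (suc N)))) (m≤n⇒m≤1+n (n≤1+n _) ∷ n≤1+n _ ∷ [])

applyRevs-lambdaReversingSeq-step : ∀ M → applyRevs (lambdaReversingSeq M) (lambdaPerm M) ≡ reverse (idPerm M) →
  applyRevs (lambdaReversingSeq M ++ (M ∷ suc M ∷ [])) (lambdaPerm (suc (suc M))) ≡ reverse (idPerm (suc (suc M)))
applyRevs-lambdaReversingSeq-step M ih = begin
  applyRevs (lambdaReversingSeq M ++ (M ∷ suc M ∷ [])) (map suc (lambdaPerm M) ++ Z)
    ≡⟨ applyRevs-append (lambdaReversingSeq M) (M ∷ suc M ∷ []) _ ⟩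
  applyRevs (M ∷ suc M ∷ []) (applyRevs (lambdaReversingSeq M) (map suc (lambdaPerm M) ++ Z))
    ≡⟨ cong (applyRevs (M ∷ suc M ∷ [])) (applyRevs-++ (lambdaReversingSeq M) (map suc (lambdaPerm M)) Z bounded) ⟩
  applyRevs (M ∷ suc M ∷ []) (applyRevs (lambdaReversingSeq M) (map suc (lambdaPerm M)) ++ Z)
    ≡⟨ cong (λ l → applyRevs (M ∷ suc M ∷ []) (l ++ Z)) (trans (applyRevs-map suc (lambdaReversingSeq M) (lambdaPerm M)) (cong (map suc) ih)) ⟩
  prefRev (suc M) (prefRev M (map suc (reverse (idPerm M)) ++ Z))
    ≡⟨ cong (prefRev (suc M)) (prefRev-whole-++ (map suc (reverse (idPerm M))) Z
         (trans (length-map suc (reverse (idPerm M))) (trans (length-reverse (idPerm M)) (length-idPerm M)))) ⟩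
  prefRev (suc M) (reverse (map suc (reverse (idPerm M))) ++ Z)
    ≡⟨ cong (λ l → prefRev (suc M) (l ++ Z)) (trans (sym (reverse-map suc (reverse (idPerm M)))) (cong (map suc) (reverse-involutive (idPerm M)))) ⟩
  prefRev (suc M) (map suc (idPerm M) ++ Z)
    ≡⟨ cong (prefRev (suc M)) (sym (++-assoc (map suc (idPerm M)) [ suc (suc M) ] [ 1 ])) ⟩
  prefRev (suc M) ((map suc (idPerm M) ++ [ suc (suc M) ]) ++ [ 1 ])
    ≡⟨ prefRev-whole-++ (map suc (idPerm M) ++ [ suc (suc M) ]) [ 1 ]
         (trans (length-++-comm (map suc (idPerm M)) [ suc (suc M) ]) (cong suc (trans (length-map suc (idPerm M)) (length-idPerm M)))) ⟩
  reverse (map suc (idPerm M) ++ [ suc (suc M) ]) ++ [ 1 ]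
    ≡⟨ sym (unfold-reverse 1 (map suc (idPerm M) ++ [ suc (suc M) ])) ⟩
  reverse (1 ∷ (map suc (idPerm M) ++ [ suc (suc M) ]))
    ≡⟨ cong reverse (sym (idPerm-∷-∷ʳ M)) ⟩
  reverse (idPerm (suc (suc M))) ∎
  where
  open ≡-Reasoning
  Z = suc (suc M) ∷ 1 ∷ []
  bounded : All (_≤ length (map suc (lambdaPerm M))) (lambdaReversingSeq M)
  bounded = subst (λ m → All (_≤ m) (lambdaReversingSeq M)) (sym (length-map suc (lambdaPerm M))) (lambdaReversingSeq-≤ M)

applyRevs-lambdaReversingSeq : ∀ N → applyRevs (lambdaReversingSeq N) (lambdaPerm N) ≡ reverse (idPerm N)
applyRevs-lambdaReversingSeq zero = refl
applyRevs-lambdaReversingSeq (suc zero) = refl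
applyRevs-lambdaReversingSeq (suc (suc zero)) = refl
applyRevs-lambdaReversingSeq (suc (suc (suc zero))) = refl
applyRevs-lambdaReversingSeq (suc (suc (suc (suc N)))) =
  applyRevs-lambdaReversingSeq-step (suc (suc N)) (applyRevs-lambdaReversingSeq (suc (suc N)))

lambdaPerm-↭ : ∀ N → lambdaPerm N ↭ idPerm N
lambdaPerm-↭ N = ↭-trans (↭-sym (applyRevs-↭ (lambdaReversingSeq N) (lambdaPerm N)))
  (subst (_↭ idPerm N) (sym (applyRevs-lambdaReversingSeq N)) (PermP.↭-reverse (idPerm N)))

lambdaPerm-IsPerm : ∀ N → IsPerm (lambdaPerm N)
lambdaPerm-IsPerm N = subst (λ m → lambdaPerm N ↭ idPerm m) (sym (length-lambdaPerm N)) (lambdaPerm-↭ N)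

lambdaPerm-≤ : ∀ N → All (_≤ N) (lambdaPerm N)
lambdaPerm-≤ N = ↭idPerm-upper N (lambdaPerm-↭ N)

lambdaPerm-ChainSortable≥ : ∀ N → ChainSortable (flip _≤_) (N ∸ 2) (lambdaPerm N)
lambdaPerm-ChainSortable≥ N = ChainSortable-by (lambdaReversingSeq N) _ (applyRevs-lambdaReversingSeq N)
  (AllPairs-reverse (idPerm-sorted N)) (≤-reflexive (length-lambdaReversingSeq N)) (lambdaReversingSeq-≤ N)

lambdaPerm-ChainSortable : ∀ N → ChainSortable _≤_ (N ∸ 1) (lambdaPerm N)
lambdaPerm-ChainSortable zero = ChainSortable-short [] z≤n
lambdaPerm-ChainSortable (suc zero) = ChainSortable-short [ 1 ] ≤-refl
lambdaPerm-ChainSortable (suc (suc N)) = ChainSortable-flip (lambdaPerm-ChainSortable≥ (suc (suc N)))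

ChainSortable-map-suc : ∀ {R k xs} → (∀ {x y} → R x y → R (suc x) (suc y)) → ChainSortable R k xs → ChainSortable R k (map suc xs)
ChainSortable-map-suc {R} {k} {xs} R-suc (js , le , bd , srt) =
  js , le , subst (λ m → All (_≤ m) js) (sym (length-map suc xs)) bd ,
  subst (AllPairs R) (sym (applyRevs-map suc js xs)) (APP.map⁺ (AllPairs.map R-suc srt))

All-map-suc : ∀ {P Q : ℕ → Set} {xs} → (∀ {x} → P x → Q (suc x)) → All P xs → All Q (map suc xs)
All-map-suc f ps = AllP.map⁺ (All.map f ps)

All-1≤-map-suc : ∀ xs → All (1 ≤_) (map suc xs)
All-1≤-map-suc xs = AllP.map⁺ (All.tabulate (λ _ → s≤s z≤n))

-- Sort xs to u; then two reversals turn u b 1 into b (reverse u) 1 and then 1 u b.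
ChainSortable-++-max-1 : ∀ {k xs b} → ChainSortable _≤_ k xs → All (1 ≤_) xs → All (_≤ b) xs → 1 ≤ b →
  ChainSortable _≤_ (k + 2) (xs ++ (b ∷ 1 ∷ []))
ChainSortable-++-max-1 {k} {xs} {b} (js , le , bd , srt) lo hi 1≤b =
  js ++ (suc n ∷ suc (suc n) ∷ []) ,
  subst (_≤ k + 2) (sym (length-++ js)) (+-monoˡ-≤ 2 le) ,
  AllP.++⁺ (All.map (λ p → subst (_ ≤_) (sym |xs++b1|) (≤-trans p (m≤n⇒m≤1+n (n≤1+n n)))) bd)
           (subst (suc n ≤_) (sym |xs++b1|) (n≤1+n (suc n)) ∷ ≤-reflexive (sym |xs++b1|) ∷ []) ,
  subst (AllPairs _≤_) (sym reversals) (AllP.++⁺ (All-applyRevs js xs lo) (1≤b ∷ []) ∷ AllPairs-∷ʳ srt (All-applyRevs js xs hi))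
  where
  open ≡-Reasoning
  n = length xs
  u = applyRevs js xs
  |xs++b1| : length (xs ++ (b ∷ 1 ∷ [])) ≡ suc (suc n)
  |xs++b1| = length-++-comm xs (b ∷ 1 ∷ [])
  |u++b| : length (u ++ [ b ]) ≡ suc n
  |u++b| = trans (length-++-comm u [ b ]) (cong suc (length-applyRevs js xs))
  reversals : applyRevs (js ++ (suc n ∷ suc (suc n) ∷ [])) (xs ++ (b ∷ 1 ∷ [])) ≡ 1 ∷ (u ++ [ b ])
  reversals = begin
    applyRevs (js ++ (suc n ∷ suc (suc n) ∷ [])) (xs ++ (b ∷ 1 ∷ []))
      ≡⟨ applyRevs-append js _ _ ⟩
    prefRev (suc (suc n)) (prefRev (suc n) (applyRevs js (xs ++ (b ∷ 1 ∷ []))))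
      ≡⟨ cong (λ l → prefRev (suc (suc n)) (prefRev (suc n) l)) (trans (applyRevs-++ js xs _ bd) (sym (++-assoc u [ b ] [ 1 ]))) ⟩
    prefRev (suc (suc n)) (prefRev (suc n) ((u ++ [ b ]) ++ [ 1 ]))
      ≡⟨ cong (prefRev (suc (suc n))) (prefRev-whole-++ (u ++ [ b ]) [ 1 ] |u++b|) ⟩
    prefRev (suc (suc n)) (reverse (u ++ [ b ]) ++ [ 1 ])
      ≡⟨ prefRev-whole (reverse (u ++ [ b ]) ++ [ 1 ])
           (trans (length-++-comm (reverse (u ++ [ b ])) [ 1 ]) (cong suc (trans (length-reverse (u ++ [ b ])) |u++b|))) ⟩
    reverse (reverse (u ++ [ b ]) ++ [ 1 ])
      ≡⟨ trans (reverse-++ (reverse (u ++ [ b ])) [ 1 ]) (cong (1 ∷_) (reverse-involutive (u ++ [ b ]))) ⟩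
    1 ∷ (u ++ [ b ]) ∎

-- Case split on which of the two final entries M + 2 and 1 of lambdaPerm (M + 2) the pattern keeps.
⊂lambdaPerm-ChainSortable : ∀ N s → s ⊆ lambdaPerm N → length s < N → ChainSortable _≤_ (N ∸ 2) s
⊂lambdaPerm-ChainSortable (suc zero) [] p lt = ChainSortable-short [] z≤n
⊂lambdaPerm-ChainSortable (suc zero) (x ∷ s) (_ ∷ʳ ()) lt
⊂lambdaPerm-ChainSortable (suc zero) (x ∷ s) (refl ∷ p) (s≤s ())
⊂lambdaPerm-ChainSortable (suc (suc M)) s p lt with ⊆-split-++ (map suc (lambdaPerm M)) (suc (suc M) ∷ 1 ∷ []) p
... | s₁ , .[] , refl , q , (_ ∷ʳ (_ ∷ʳ [])) =
  subst (ChainSortable _≤_ M) (sym (++-identityʳ s₁))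
    (ChainSortable-⊆ q (ChainSortable-weaken (m∸n≤m M 1) (ChainSortable-map-suc s≤s (lambdaPerm-ChainSortable M))))
... | s₁ , .(suc (suc M) ∷ []) , refl , q , (refl ∷ (_ ∷ʳ [])) =
  ChainSortable-weaken (m∸n≤m M 1)
    (ChainSortable-∷ʳ (SubP.All-resp-⊆ q (All-map-suc (λ p → m≤n⇒m≤1+n (s≤s p)) (lambdaPerm-≤ M)))
      (ChainSortable-⊆ q (ChainSortable-map-suc s≤s (lambdaPerm-ChainSortable M))))
... | s₁ , .(1 ∷ []) , refl , q , (_ ∷ʳ (refl ∷ [])) = keeps1 M s₁ q
  where
  keeps1 : ∀ M s₁ → s₁ ⊆ map suc (lambdaPerm M) → ChainSortable _≤_ M (s₁ ++ [ 1 ])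
  keeps1 zero [] q = ChainSortable-short [ 1 ] ≤-refl
  keeps1 (suc M) s₁ q =
    ChainSortable-weaken (s≤s (m∸n≤m M 1)) (ChainSortable-flip
      (ChainSortable-∷ʳ (SubP.All-resp-⊆ q (All-1≤-map-suc (lambdaPerm (suc M))))
        (ChainSortable-⊆ q (ChainSortable-map-suc s≤s (lambdaPerm-ChainSortable≥ (suc M))))))
... | [] , .(suc (suc M) ∷ 1 ∷ []) , refl , q , (refl ∷ (refl ∷ [])) = keepsOnlyBoth M lt
  where
  keepsOnlyBoth : ∀ M → 2 < suc (suc M) → ChainSortable _≤_ M (suc (suc M) ∷ 1 ∷ [])
  keepsOnlyBoth zero (s≤s (s≤s ()))
  keepsOnlyBoth (suc M) _ = ChainSortable-by [ 2 ] (1 ∷ suc (suc (suc M)) ∷ []) refl ((s≤s z≤n ∷ []) ∷ [] ∷ []) (s≤s z≤n) (≤-refl ∷ [])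
... | x ∷ s₁ , .(suc (suc M) ∷ 1 ∷ []) , refl , q , (refl ∷ (refl ∷ [])) with ⊆-map⁻ suc (lambdaPerm M) q
... | t , e , q' =
  subst (λ z → ChainSortable _≤_ M (z ++ (suc (suc M) ∷ 1 ∷ []))) (sym e)
    (keepsBoth M t e q' (s≤s⁻¹ (s≤s⁻¹ (subst (_< suc (suc M)) |t++M+2,1| (subst (λ z → length (z ++ (suc (suc M) ∷ 1 ∷ [])) < suc (suc M)) e lt)))))
  where
  |t++M+2,1| : length (map suc t ++ (suc (suc M) ∷ 1 ∷ [])) ≡ suc (suc (length t))
  |t++M+2,1| = trans (length-++-comm (map suc t) (suc (suc M) ∷ 1 ∷ [])) (cong (λ m → suc (suc m)) (length-map suc t))
  keepsBoth : ∀ M t → x ∷ s₁ ≡ map suc t → t ⊆ lambdaPerm M → length t < M →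
    ChainSortable _≤_ M (map suc t ++ (suc (suc M) ∷ 1 ∷ []))
  keepsBoth M [] () q l
  keepsBoth (suc (suc M)) t@(_ ∷ _) _ q l =
    ChainSortable-weaken (≤-reflexive (+-comm M 2))
      (ChainSortable-++-max-1 (ChainSortable-map-suc s≤s (⊂lambdaPerm-ChainSortable (suc (suc M)) t q l)) (All-1≤-map-suc t)
        (All-map-suc (λ p → m≤n⇒m≤1+n (s≤s p)) (SubP.All-resp-⊆ q (lambdaPerm-≤ (suc (suc M))))) (s≤s z≤n))
  keepsBoth (suc zero) (_ ∷ _) _ q (s≤s ())

adjacencies-map-suc : ∀ xs → adjacencies adjB (map suc xs) ≡ adjacencies adjB xs
adjacencies-map-suc = adjacencies-map adjB adjB suc (λ _ _ → refl)

adjacencies-lambdaPerm : ∀ N → adjacencies adjB (lambdaPerm (suc (suc N)) ++ [ suc (suc (suc N)) ]) ≡ 1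
adjacencies-lambdaPerm zero = refl
adjacencies-lambdaPerm (suc zero) = refl
adjacencies-lambdaPerm (suc (suc N)) = begin
    adjacencies adjB ((map suc (lambdaPerm M) ++ (suc (suc M) ∷ 1 ∷ [])) ++ [ suc (suc (suc M)) ])
  ≡⟨ cong (λ l → adjacencies adjB (l ++ [ suc (suc (suc M)) ])) (trans (sym (++-assoc (map suc (lambdaPerm M)) [ suc (suc M) ] [ 1 ])) (cong (_++ [ 1 ]) (sym (map-++ suc (lambdaPerm M) [ suc M ])))) ⟩
    adjacencies adjB ((map suc (lambdaPerm M ++ [ suc M ]) ++ [ 1 ]) ++ [ suc (suc (suc M)) ])
  ≡⟨ adjacencies-∷ʳ adjB (map suc (lambdaPerm M ++ [ suc M ])) 1 (suc (suc (suc M))) ⟩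
    adjacencies adjB (map suc (lambdaPerm M ++ [ suc M ]) ++ [ 1 ]) + 0
  ≡⟨ +-identityʳ _ ⟩
    adjacencies adjB (map suc (lambdaPerm M ++ [ suc M ]) ++ [ 1 ])
  ≡⟨ cong (λ l → adjacencies adjB (l ++ [ 1 ])) (map-++ suc (lambdaPerm M) [ suc M ]) ⟩
    adjacencies adjB ((map suc (lambdaPerm M) ++ [ suc (suc M) ]) ++ [ 1 ])
  ≡⟨ adjacencies-∷ʳ adjB (map suc (lambdaPerm M)) (suc (suc M)) 1 ⟩
    adjacencies adjB (map suc (lambdaPerm M) ++ [ suc (suc M) ]) + 0
  ≡⟨ +-identityʳ _ ⟩
    adjacencies adjB (map suc (lambdaPerm M) ++ [ suc (suc M) ])
  ≡⟨ cong (adjacencies adjB) (sym (map-++ suc (lambdaPerm M) [ suc M ])) ⟩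
    adjacencies adjB (map suc (lambdaPerm M ++ [ suc M ]))
  ≡⟨ adjacencies-map-suc (lambdaPerm M ++ [ suc M ]) ⟩
    adjacencies adjB (lambdaPerm M ++ [ suc M ])
  ≡⟨ adjacencies-lambdaPerm N ⟩
    1
  ∎
  where
  open ≡-Reasoning
  M = suc (suc N)

sucv : ℕ × Deco → ℕ × Deco
sucv (v , d) = (suc v , d)

extT : ℕ → Peg → Peg
extT n p = (suc (suc n) , dot) ∷ (p ++ [ (suc n , dot) ])

extL : ℕ → Peg → Peg
extL n p = map sucv p ++ ((suc (suc n) , dot) ∷ (1 , dot) ∷ [])

-- thetaPeg n and lambdaPeg n are Θe/Θo and Λe/Λo of length n ≥ 2; shorter arguments give junk.
thetaPeg : ℕ → Peg
thetaPeg zero = []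
thetaPeg (suc zero) = []
thetaPeg (suc (suc zero)) = (2 , dot) ∷ (1 , plus) ∷ []
thetaPeg (suc (suc (suc zero))) = (3 , dot) ∷ (1 , minus) ∷ (2 , dot) ∷ []
thetaPeg (suc (suc (suc (suc n)))) = extT (suc (suc n)) (thetaPeg (suc (suc n)))

lambdaPeg : ℕ → Peg
lambdaPeg zero = []
lambdaPeg (suc zero) = []
lambdaPeg (suc (suc zero)) = (2 , plus) ∷ (1 , dot) ∷ []
lambdaPeg (suc (suc (suc zero))) = (2 , minus) ∷ (3 , dot) ∷ (1 , dot) ∷ []
lambdaPeg (suc (suc (suc (suc n)))) = extL (suc (suc n)) (lambdaPeg (suc (suc n)))

length-extT : ∀ n p → length p ≡ n → length (extT n p) ≡ suc (suc n)
length-extT n p l = cong suc (trans (length-++-comm p [ (suc n , dot) ]) (cong suc l))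

length-extL : ∀ n p → length p ≡ n → length (extL n p) ≡ suc (suc n)
length-extL n p l = trans (length-++-comm (map sucv p) ((suc (suc n) , dot) ∷ (1 , dot) ∷ []))
  (cong (λ m → suc (suc m)) (trans (length-map sucv p) l))

length-thetaPeg : ∀ n → length (thetaPeg (suc (suc n))) ≡ suc (suc n)
length-thetaPeg zero = refl
length-thetaPeg (suc zero) = refl
length-thetaPeg (suc (suc n)) = length-extT (suc (suc n)) (thetaPeg (suc (suc n))) (length-thetaPeg n)

length-lambdaPeg : ∀ n → length (lambdaPeg (suc (suc n))) ≡ suc (suc n)
length-lambdaPeg zero = refl
length-lambdaPeg (suc zero) = refl
length-lambdaPeg (suc (suc n)) = length-extL (suc (suc n)) (lambdaPeg (suc (suc n))) (length-lambdaPeg n)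

lastL-thetaPerm : ∀ K → lastL (suc (suc K)) (reverse (thetaPerm (suc K))) ≡ suc K
lastL-thetaPerm K = trans (cong (lastL (suc (suc K))) (unfold-reverse (suc K) (reverse (thetaPerm K))))
  (lastL-∷ʳ _ (reverse (reverse (thetaPerm K))) (suc K))

strips-thetaPerm : ∀ K → strips (thetaPerm (suc (suc (suc (suc K))))) ≡ [ suc (suc (suc (suc K))) ] ∷ (strips (thetaPerm (suc (suc K))) ++ [ [ suc (suc (suc K)) ] ])
strips-thetaPerm K = trans (cong strips (thetaPerm-suc-suc (suc (suc K))))
  (trans (strips-∷-nonadjacent (suc (suc (suc (suc K)))) (suc (suc K)) (reverse (thetaPerm (suc K)) ++ [ suc (suc (suc K)) ]) (adjB-suc-suc (suc (suc K))))
    (cong ([ suc (suc (suc (suc K))) ] ∷_) (strips-∷-∷ʳ-nonadjacent (suc (suc K)) (reverse (thetaPerm (suc K))) (suc (suc (suc K)))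
       (trans (cong (λ z → adjB z (suc (suc (suc K)))) (lastL-thetaPerm K)) (adjB-+2 (suc K))))))

peg-thetaPerm-step : ∀ K → peg (thetaPerm (suc (suc (suc (suc K))))) ≡ extT (length (strips (thetaPerm (suc (suc K))))) (peg (thetaPerm (suc (suc K))))
peg-thetaPerm-step K = begin
    peg (thetaPerm (suc (suc N)))
  ≡⟨ cong (λ S → zip (std (map minL S)) (map decoOf S)) (strips-thetaPerm K) ⟩
    zip (std (a ∷ map minL (B ++ [ [ c ] ]))) (dot ∷ map decoOf (B ++ [ [ c ] ]))
  ≡⟨ cong₂ (λ X Y → zip X (dot ∷ Y)) (trans (cong (λ l → std (a ∷ l)) (map-++ minL B [ [ c ] ])) (std-∷-∷ʳ a c (map minL B) allc ≤-refl)) (map-++ decoOf B [ [ c ] ]) ⟩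
    zip (suc (suc m) ∷ (std (map minL B) ++ [ suc m ])) (dot ∷ (map decoOf B ++ [ dot ]))
  ≡⟨ zip-∷-∷ʳ (suc (suc m)) (std (map minL B)) (suc m) dot (map decoOf B) dot (trans (length-map _ (map minL B)) (trans (length-map minL B) (sym (length-map decoOf B)))) ⟩
    extT m (peg (thetaPerm N))
  ≡⟨ cong (λ z → extT z (peg (thetaPerm N))) (length-map minL B) ⟩
    extT (length B) (peg (thetaPerm N))
  ∎
  where
  open ≡-Reasoning
  N = suc (suc K)
  a = suc (suc N)
  c = suc N
  B = strips (thetaPerm N)
  m = length (map minL B)
  allc : All (_< c) (map minL B)
  allc = All-minL-strips (thetaPerm N) (IsPerm⇒Unique (thetaPerm N) (thetaPerm-IsPerm N)) (All.map s≤s (thetaPerm-≤ N))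

peg-thetaPerm : ∀ n → peg (thetaPerm (suc (suc (suc n)))) ≡ thetaPeg (suc (suc n))
peg-thetaPerm zero = refl
peg-thetaPerm (suc zero) = refl
peg-thetaPerm (suc (suc n)) = begin
  peg (thetaPerm (suc (suc (suc (suc (suc n))))))
    ≡⟨ peg-thetaPerm-step (suc n) ⟩
  extT (length (strips (thetaPerm (suc (suc (suc n)))))) (peg (thetaPerm (suc (suc (suc n)))))
    ≡⟨ cong (λ z → extT z (peg (thetaPerm (suc (suc (suc n)))))) |strips| ⟩
  extT (suc (suc n)) (peg (thetaPerm (suc (suc (suc n)))))
    ≡⟨ cong (extT (suc (suc n))) (peg-thetaPerm n) ⟩
  extT (suc (suc n)) (thetaPeg (suc (suc n))) ∎
  where
  open ≡-Reasoning
  |strips| : length (strips (thetaPerm (suc (suc (suc n))))) ≡ suc (suc n)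
  |strips| = trans (sym (length-peg (thetaPerm (suc (suc (suc n)))))) (trans (cong length (peg-thetaPerm n)) (length-thetaPeg n))

Short : List ℕ → Set
Short b = take2 b ≡ b

thetaPerm-stripsShort : ∀ N → All Short (strips (thetaPerm (suc (suc (suc N)))))
thetaPerm-stripsShort zero = refl ∷ refl ∷ []
thetaPerm-stripsShort (suc zero) = refl ∷ refl ∷ refl ∷ []
thetaPerm-stripsShort (suc (suc K)) = subst (All Short) (sym (strips-thetaPerm (suc K)))
  (refl ∷ AllP.++⁺ (thetaPerm-stripsShort K) (refl ∷ []))

-- When no strip is longer than 2, the chosen subsequence is all of γ.
minPeg-peg-short : ∀ γ → IsPerm γ → All Short (strips γ) → minPeg (peg γ) ≡ γ
minPeg-peg-short γ p short = begin
  minPeg (peg γ)                        ≡⟨ sym (proj₂ (pick-⊆×std γ p)) ⟩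
  std (pick (strips γ))                 ≡⟨ cong std (concatMap-cong-local short) ⟩
  std (concatMap id (strips γ))         ≡⟨ cong (λ l → std (concat l)) (map-id (strips γ)) ⟩
  std (concat (strips γ))               ≡⟨ cong std (proj₁ (strips-concat-Run γ (IsPerm⇒Unique γ p))) ⟩
  std γ                                 ≡⟨ std-IsPerm γ p ⟩
  γ                                     ∎
  where open ≡-Reasoning

lastL-map-suc-lambdaPerm : ∀ K d → lastL d (map suc (lambdaPerm (suc (suc K)))) ≡ 2
lastL-map-suc-lambdaPerm K d = trans (cong (lastL d) (trans (map-++ suc (map suc (lambdaPerm K)) (suc (suc K) ∷ 1 ∷ []))
    (sym (++-assoc (map suc (map suc (lambdaPerm K))) [ suc (suc (suc K)) ] [ 2 ]))))
  (lastL-∷ʳ d (map suc (map suc (lambdaPerm K)) ++ [ suc (suc (suc K)) ]) 2)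

strips-lambdaPerm : ∀ K → strips (lambdaPerm (suc (suc (suc (suc K))))) ≡ map (map suc) (strips (lambdaPerm (suc (suc K)))) ++ ([ suc (suc (suc (suc K))) ] ∷ [ 1 ] ∷ [])
strips-lambdaPerm K = begin
  strips (map suc (lambdaPerm N) ++ (a ∷ 1 ∷ []))
    ≡⟨ cong strips (sym (++-assoc (map suc (lambdaPerm N)) [ a ] [ 1 ])) ⟩
  strips ((map suc (lambdaPerm N) ++ [ a ]) ++ [ 1 ])
    ≡⟨ strips-∷ʳ-nonadjacent (map suc (lambdaPerm N) ++ [ a ]) 1 0 (cong (λ z → adjB z 1) (lastL-∷ʳ 0 (map suc (lambdaPerm N)) a)) ⟩
  strips (map suc (lambdaPerm N) ++ [ a ]) ++ [ [ 1 ] ]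
    ≡⟨ cong (_++ [ [ 1 ] ]) (strips-∷ʳ-nonadjacent (map suc (lambdaPerm N)) a 0 (cong (λ z → adjB z a) (lastL-map-suc-lambdaPerm K 0))) ⟩
  (strips (map suc (lambdaPerm N)) ++ [ [ a ] ]) ++ [ [ 1 ] ]
    ≡⟨ cong (λ S → (S ++ [ [ a ] ]) ++ [ [ 1 ] ]) (strips-map-suc (lambdaPerm N)) ⟩
  (map (map suc) (strips (lambdaPerm N)) ++ [ [ a ] ]) ++ [ [ 1 ] ]
    ≡⟨ ++-assoc (map (map suc) (strips (lambdaPerm N))) [ [ a ] ] [ [ 1 ] ] ⟩
  map (map suc) (strips (lambdaPerm N)) ++ ([ a ] ∷ [ 1 ] ∷ []) ∎
  where
  open ≡-Reasoning
  N = suc (suc K)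
  a = suc (suc N)

minL-map-suc : ∀ x xs → minL (map suc (x ∷ xs)) ≡ suc (minL (x ∷ xs))
minL-map-suc x [] = refl
minL-map-suc x (y ∷ xs) = cong (suc x ⊓_) (minL-map-suc y xs)

Run-nonempty : ∀ {b} → Run b → Σ ℕ λ x → Σ (List ℕ) λ xs → b ≡ x ∷ xs
Run-nonempty (singleton x) = x , [] , refl
Run-nonempty (ascending m k) = m , _ , refl
Run-nonempty (descending m k) = _ , _ , refl

decoOf-map-suc : ∀ b → decoOf (map suc b) ≡ decoOf b
decoOf-map-suc [] = refl
decoOf-map-suc (x ∷ []) = refl
decoOf-map-suc (x ∷ y ∷ b) = refl

peg-lambdaPerm-step : ∀ K → peg (lambdaPerm (suc (suc (suc (suc K))))) ≡ extL (length (strips (lambdaPerm (suc (suc K))))) (peg (lambdaPerm (suc (suc K))))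
peg-lambdaPerm-step K = begin
    peg (lambdaPerm (suc (suc N)))
  ≡⟨ cong (λ S → zip (std (map minL S)) (map decoOf S)) (strips-lambdaPerm K) ⟩
    zip (std (map minL (map (map suc) B ++ ([ a ] ∷ [ 1 ] ∷ [])))) (map decoOf (map (map suc) B ++ ([ a ] ∷ [ 1 ] ∷ [])))
  ≡⟨ cong₂ zip (trans (cong std (trans (map-++ minL (map (map suc) B) ([ a ] ∷ [ 1 ] ∷ [])) (cong (_++ (a ∷ 1 ∷ [])) minEq)))
                      (std-map-suc-++ a (map minL B) lo hi (s≤s (s≤s z≤n))))
               (trans (map-++ decoOf (map (map suc) B) ([ a ] ∷ [ 1 ] ∷ [])) (cong (_++ (dot ∷ dot ∷ [])) decEq)) ⟩
    zip (map suc (std (map minL B)) ++ (suc (suc m) ∷ 1 ∷ [])) (map decoOf B ++ (dot ∷ dot ∷ []))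
  ≡⟨ zip-map-++ suc sucv (λ a b → refl) (std (map minL B)) (map decoOf B) (suc (suc m)) 1 dot dot
       (trans (length-map _ (map minL B)) (trans (length-map minL B) (sym (length-map decoOf B)))) ⟩
    extL m (peg (lambdaPerm N))
  ≡⟨ cong (λ z → extL z (peg (lambdaPerm N))) (length-map minL B) ⟩
    extL (length B) (peg (lambdaPerm N))
  ∎
  where
  open ≡-Reasoning
  N = suc (suc K)
  a = suc (suc N)
  B = strips (lambdaPerm N)
  m = length (map minL B)
  unique : Unique (lambdaPerm N)
  unique = IsPerm⇒Unique (lambdaPerm N) (lambdaPerm-IsPerm N)
  minEq : map minL (map (map suc) B) ≡ map suc (map minL B)
  minEq = trans (sym (map-∘ B)) (trans (map-cong-local (All.map minL-suc (proj₂ (strips-concat-Run (lambdaPerm N) unique)))) (map-∘ B))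
    where
    minL-suc : ∀ {b} → Run b → minL (map suc b) ≡ suc (minL b)
    minL-suc r with Run-nonempty r
    ... | x , xs , refl = minL-map-suc x xs
  decEq : map decoOf (map (map suc) B) ≡ map decoOf B
  decEq = trans (sym (map-∘ B)) (map-cong decoOf-map-suc B)
  lo : All (1 ≤_) (map minL B)
  lo = All-minL-strips (lambdaPerm N) unique (↭idPerm-lower N (lambdaPerm-↭ N))
  hi : All (λ y → suc y < a) (map minL B)
  hi = All-minL-strips (lambdaPerm N) unique (All.map (λ p → s≤s (s≤s p)) (lambdaPerm-≤ N))

peg-lambdaPerm : ∀ n → peg (lambdaPerm (suc (suc (suc n)))) ≡ lambdaPeg (suc (suc n))
peg-lambdaPerm zero = refl
peg-lambdaPerm (suc zero) = refl
peg-lambdaPerm (suc (suc n)) = begin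
  peg (lambdaPerm (suc (suc (suc (suc (suc n))))))
    ≡⟨ peg-lambdaPerm-step (suc n) ⟩
  extL (length (strips (lambdaPerm (suc (suc (suc n)))))) (peg (lambdaPerm (suc (suc (suc n)))))
    ≡⟨ cong (λ z → extL z (peg (lambdaPerm (suc (suc (suc n)))))) |strips| ⟩
  extL (suc (suc n)) (peg (lambdaPerm (suc (suc (suc n)))))
    ≡⟨ cong (extL (suc (suc n))) (peg-lambdaPerm n) ⟩
  extL (suc (suc n)) (lambdaPeg (suc (suc n))) ∎
  where
  open ≡-Reasoning
  |strips| : length (strips (lambdaPerm (suc (suc (suc n))))) ≡ suc (suc n)
  |strips| = trans (sym (length-peg (lambdaPerm (suc (suc (suc n)))))) (trans (cong length (peg-lambdaPerm n)) (length-lambdaPeg n))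

lambdaPerm-stripsShort : ∀ N → All Short (strips (lambdaPerm (suc (suc (suc N)))))
lambdaPerm-stripsShort zero = refl ∷ refl ∷ []
lambdaPerm-stripsShort (suc zero) = refl ∷ refl ∷ refl ∷ []
lambdaPerm-stripsShort (suc (suc K)) = subst (All Short) (sym (strips-lambdaPerm (suc K)))
  (AllP.++⁺ (AllP.map⁺ (All.map (λ e → trans (take-map 2 _) (cong (map suc) e)) (lambdaPerm-stripsShort K))) (refl ∷ refl ∷ []))

pegPrefRev-++ : ∀ j (xs ys : Peg) → j ≤ length xs → pegPrefRev j (xs ++ ys) ≡ pegPrefRev j xs ++ ys
pegPrefRev-++ j xs ys p rewrite take-++ˡ j xs ys p | drop-++ˡ j xs ys p =
  sym (++-assoc (map flipE (reverse (take j xs))) (drop j xs) ys)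

applyPegRevs-++ : ∀ js (xs ys : Peg) → All (_≤ length xs) js → applyPegRevs js (xs ++ ys) ≡ applyPegRevs js xs ++ ys
applyPegRevs-++ [] xs ys _ = refl
applyPegRevs-++ (j ∷ js) xs ys (p ∷ ps) rewrite pegPrefRev-++ j xs ys p =
  applyPegRevs-++ js (pegPrefRev j xs) ys (subst (λ m → All (_≤ m) js) (sym (length-pegPrefRev j xs)) ps)

applyPegRevs-append : ∀ js ks (xs : Peg) → applyPegRevs (js ++ ks) xs ≡ applyPegRevs ks (applyPegRevs js xs)
applyPegRevs-append [] ks xs = refl
applyPegRevs-append (j ∷ js) ks xs = applyPegRevs-append js ks (pegPrefRev j xs)

flipE-involutive : ∀ e → flipE (flipE e) ≡ e
flipE-involutive (v , plus) = refl
flipE-involutive (v , minus) = refl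
flipE-involutive (v , dot) = refl

map-flipE-sucv : ∀ xs → map flipE (map sucv xs) ≡ map sucv (map flipE xs)
map-flipE-sucv xs = trans (sym (map-∘ xs)) (map-∘ xs)

pegPrefRev-map-sucv : ∀ j xs → pegPrefRev j (map sucv xs) ≡ map sucv (pegPrefRev j xs)
pegPrefRev-map-sucv j xs rewrite take-map {f = sucv} j xs | drop-map {f = sucv} j xs =
  trans (cong (_++ map sucv (drop j xs)) (trans (cong (map flipE) (sym (reverse-map sucv (take j xs)))) (map-flipE-sucv (reverse (take j xs)))))
        (sym (map-++ sucv (map flipE (reverse (take j xs))) (drop j xs)))

applyPegRevs-map-sucv : ∀ js xs → applyPegRevs js (map sucv xs) ≡ map sucv (applyPegRevs js xs)
applyPegRevs-map-sucv [] xs = refl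
applyPegRevs-map-sucv (j ∷ js) xs rewrite pegPrefRev-map-sucv j xs = applyPegRevs-map-sucv js (pegPrefRev j xs)

pegPrefRev-whole : ∀ {j} (xs : Peg) → length xs ≡ j → pegPrefRev j xs ≡ map flipE (reverse xs)
pegPrefRev-whole xs refl rewrite take-all (length xs) xs ≤-refl | drop-all (length xs) xs ≤-refl = ++-identityʳ _

pegPrefRev-whole-++ : ∀ {j} (xs ys : Peg) → length xs ≡ j → pegPrefRev j (xs ++ ys) ≡ map flipE (reverse xs) ++ ys
pegPrefRev-whole-++ xs ys refl = trans (pegPrefRev-++ (length xs) xs ys ≤-refl) (cong (_++ ys) (pegPrefRev-whole xs refl))

flipReverse-involutive : ∀ (p : Peg) → map flipE (reverse (map flipE (reverse p))) ≡ p
flipReverse-involutive p = begin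
  map flipE (reverse (map flipE (reverse p)))     ≡⟨ cong (map flipE) (sym (reverse-map flipE (reverse p))) ⟩
  map flipE (map flipE (reverse (reverse p)))     ≡⟨ sym (map-∘ (reverse (reverse p))) ⟩
  map (flipE ∘ flipE) (reverse (reverse p))       ≡⟨ map-cong flipE-involutive _ ⟩
  map id (reverse (reverse p))                    ≡⟨ map-id _ ⟩
  reverse (reverse p)                             ≡⟨ reverse-involutive p ⟩
  p                                               ∎
  where open ≡-Reasoning

length-flipReverse : ∀ (p : Peg) → length (map flipE (reverse p)) ≡ length p
length-flipReverse p = trans (length-map flipE (reverse p)) (length-reverse p)

PegSorted-++ : ∀ q n → length q ≡ n → PegSorted q → PegSorted (q ++ ((suc n , dot) ∷ (suc (suc n) , dot) ∷ []))
PegSorted-++ q n refl (sorted , noMinus) = identity , AllP.++⁺ noMinus ((λ ()) ∷ (λ ()) ∷ [])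
  where
  open ≡-Reasoning
  identity : map proj₁ (q ++ ((suc n , dot) ∷ (suc (suc n) , dot) ∷ [])) ≡ idPerm (length (q ++ ((suc n , dot) ∷ (suc (suc n) , dot) ∷ [])))
  identity = begin
    map proj₁ (q ++ ((suc n , dot) ∷ (suc (suc n) , dot) ∷ [])) ≡⟨ map-++ proj₁ q _ ⟩
    map proj₁ q ++ (suc n ∷ suc (suc n) ∷ [])     ≡⟨ cong (_++ (suc n ∷ suc (suc n) ∷ [])) sorted ⟩
    idPerm n ++ (suc n ∷ suc (suc n) ∷ [])         ≡⟨ sym (++-assoc (idPerm n) [ suc n ] [ suc (suc n) ]) ⟩
    (idPerm n ++ [ suc n ]) ++ [ suc (suc n) ]     ≡⟨ cong (_++ [ suc (suc n) ]) (sym (idPerm-∷ʳ n)) ⟩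
    idPerm (suc n) ++ [ suc (suc n) ]              ≡⟨ sym (idPerm-∷ʳ (suc n)) ⟩
    idPerm (suc (suc n))                           ≡⟨ cong idPerm (sym (length-++-comm q ((suc n , dot) ∷ (suc (suc n) , dot) ∷ []))) ⟩
    idPerm (length (q ++ ((suc n , dot) ∷ (suc (suc n) , dot) ∷ []))) ∎

-- The sorted peg permutation that lambdaPeg (n + 2) reaches from that of lambdaPeg n.
sortedExtL : ℕ → Peg → Peg
sortedExtL n r = (1 , dot) ∷ (map sucv r ++ [ (suc (suc n) , dot) ])

PegSorted-sortedExtL : ∀ r n → length r ≡ n → PegSorted r → PegSorted (sortedExtL n r)
PegSorted-sortedExtL r n refl (sorted , noMinus) = identity , (λ ()) ∷ AllP.++⁺ (AllP.map⁺ noMinus) ((λ ()) ∷ [])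
  where
  open ≡-Reasoning
  identity : 1 ∷ map proj₁ (map sucv r ++ [ (suc (suc n) , dot) ]) ≡ idPerm (suc (length (map sucv r ++ [ (suc (suc n) , dot) ])))
  identity = begin
    1 ∷ map proj₁ (map sucv r ++ [ (suc (suc n) , dot) ])   ≡⟨ cong (1 ∷_) (map-++ proj₁ (map sucv r) _) ⟩
    1 ∷ (map proj₁ (map sucv r) ++ [ suc (suc n) ])          ≡⟨ cong (λ l → 1 ∷ (l ++ [ suc (suc n) ])) (trans (sym (map-∘ r)) (map-∘ r)) ⟩
    1 ∷ (map suc (map proj₁ r) ++ [ suc (suc n) ])           ≡⟨ cong (λ l → 1 ∷ (map suc l ++ [ suc (suc n) ])) sorted ⟩
    1 ∷ (map suc (idPerm n) ++ [ suc (suc n) ])              ≡⟨ sym (idPerm-∷-∷ʳ n) ⟩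
    idPerm (suc (suc n))                                     ≡⟨ cong (λ m → idPerm (suc m)) (sym (trans (length-++-comm (map sucv r) _) (cong suc (length-map sucv r)))) ⟩
    idPerm (suc (length (map sucv r ++ [ (suc (suc n) , dot) ]))) ∎

applyPegRevs-extT : ∀ n p js → length p ≡ n → All (_≤ n) js →
  applyPegRevs (suc (suc n) ∷ suc n ∷ js) (extT n p) ≡ applyPegRevs js p ++ ((suc n , dot) ∷ (suc (suc n) , dot) ∷ [])
applyPegRevs-extT n p js l bd = begin
    applyPegRevs js (pegPrefRev (suc n) (pegPrefRev (suc (suc n)) (extT n p)))
  ≡⟨ cong (λ z → applyPegRevs js (pegPrefRev (suc n) z)) first ⟩
    applyPegRevs js (pegPrefRev (suc n) (((suc n , dot) ∷ map flipE (reverse p)) ++ [ (suc (suc n) , dot) ]))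
  ≡⟨ cong (applyPegRevs js) second ⟩
    applyPegRevs js (p ++ ((suc n , dot) ∷ (suc (suc n) , dot) ∷ []))
  ≡⟨ applyPegRevs-++ js p _ (subst (λ m → All (_≤ m) js) (sym l) bd) ⟩
    applyPegRevs js p ++ ((suc n , dot) ∷ (suc (suc n) , dot) ∷ [])
  ∎
  where
  open ≡-Reasoning
  first : pegPrefRev (suc (suc n)) (extT n p) ≡ ((suc n , dot) ∷ map flipE (reverse p)) ++ [ (suc (suc n) , dot) ]
  first = trans (pegPrefRev-whole (extT n p) (length-extT n p l))
    (trans (cong (map flipE) (trans (unfold-reverse (suc (suc n) , dot) (p ++ [ (suc n , dot) ]))
                                    (cong (_++ [ (suc (suc n) , dot) ]) (reverse-++ p [ (suc n , dot) ]))))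
      (map-++ flipE ((suc n , dot) ∷ reverse p) [ (suc (suc n) , dot) ]))
  second : pegPrefRev (suc n) (((suc n , dot) ∷ map flipE (reverse p)) ++ [ (suc (suc n) , dot) ]) ≡ p ++ ((suc n , dot) ∷ (suc (suc n) , dot) ∷ [])
  second = trans (pegPrefRev-whole-++ ((suc n , dot) ∷ map flipE (reverse p)) [ (suc (suc n) , dot) ] (cong suc (trans (length-flipReverse p) l)))
    (trans (cong (λ z → map flipE z ++ [ (suc (suc n) , dot) ]) (unfold-reverse (suc n , dot) (map flipE (reverse p))))
      (trans (cong (_++ [ (suc (suc n) , dot) ]) (trans (map-++ flipE (reverse (map flipE (reverse p))) [ (suc n , dot) ])
                                                      (cong (_++ [ (suc n , dot) ]) (flipReverse-involutive p))))
        (++-assoc p [ (suc n , dot) ] [ (suc (suc n) , dot) ])))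

applyPegRevs-extL : ∀ n p r js → length p ≡ n → All (_≤ n) js → applyPegRevs js p ≡ map flipE (reverse r) →
  applyPegRevs (js ++ (n ∷ suc n ∷ [])) (extL n p) ≡ map flipE (reverse (sortedExtL n r))
applyPegRevs-extL n p r js l bd e = begin
    applyPegRevs (js ++ (n ∷ suc n ∷ [])) (map sucv p ++ Z)
  ≡⟨ applyPegRevs-append js (n ∷ suc n ∷ []) _ ⟩
    applyPegRevs (n ∷ suc n ∷ []) (applyPegRevs js (map sucv p ++ Z))
  ≡⟨ cong (applyPegRevs (n ∷ suc n ∷ [])) (trans (applyPegRevs-++ js (map sucv p) Z bd') (cong (_++ Z) (trans (applyPegRevs-map-sucv js p) (cong (map sucv) e)))) ⟩
    pegPrefRev (suc n) (pegPrefRev n (map sucv Q ++ Z))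
  ≡⟨ cong (pegPrefRev (suc n)) (pegPrefRev-whole-++ (map sucv Q) Z |sucvQ|) ⟩
    pegPrefRev (suc n) (map flipE (reverse (map sucv Q)) ++ Z)
  ≡⟨ cong (λ z → pegPrefRev (suc n) (z ++ Z)) middle ⟩
    pegPrefRev (suc n) (map sucv r ++ Z)
  ≡⟨ cong (pegPrefRev (suc n)) (sym (++-assoc (map sucv r) [ (suc (suc n) , dot) ] [ (1 , dot) ])) ⟩
    pegPrefRev (suc n) ((map sucv r ++ [ (suc (suc n) , dot) ]) ++ [ (1 , dot) ])
  ≡⟨ pegPrefRev-whole-++ (map sucv r ++ [ (suc (suc n) , dot) ]) [ (1 , dot) ] |sucvr++| ⟩
    map flipE (reverse (map sucv r ++ [ (suc (suc n) , dot) ])) ++ [ (1 , dot) ]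
  ≡⟨ sym (map-++ flipE (reverse (map sucv r ++ [ (suc (suc n) , dot) ])) [ (1 , dot) ]) ⟩
    map flipE (reverse (map sucv r ++ [ (suc (suc n) , dot) ]) ++ [ (1 , dot) ])
  ≡⟨ cong (map flipE) (sym (unfold-reverse (1 , dot) (map sucv r ++ [ (suc (suc n) , dot) ]))) ⟩
    map flipE (reverse (sortedExtL n r))
  ∎
  where
  open ≡-Reasoning
  Z = (suc (suc n) , dot) ∷ (1 , dot) ∷ []
  Q = map flipE (reverse r)
  bd' : All (_≤ length (map sucv p)) js
  bd' = subst (λ m → All (_≤ m) js) (sym (trans (length-map sucv p) l)) bd
  |Q| : length Q ≡ n
  |Q| = trans (cong length (sym e)) (trans (length-applyPegRevs js p) l)
  |sucvQ| : length (map sucv Q) ≡ n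
  |sucvQ| = trans (length-map sucv Q) |Q|
  |sucvr++| : length (map sucv r ++ [ (suc (suc n) , dot) ]) ≡ suc n
  |sucvr++| = trans (length-++-comm (map sucv r) _) (cong suc (trans (length-map sucv r) (trans (sym (length-flipReverse r)) |Q|)))
  middle : map flipE (reverse (map sucv Q)) ≡ map sucv r
  middle = trans (cong (map flipE) (sym (reverse-map sucv Q))) (trans (map-flipE-sucv (reverse Q)) (cong (map sucv) (flipReverse-involutive r)))

countdown : ℕ → List ℕ
countdown zero = []
countdown (suc n) = suc n ∷ countdown n

length-countdown : ∀ n → length (countdown n) ≡ n
length-countdown zero = refl
length-countdown (suc n) = cong suc (length-countdown n)

countdown-≤ : ∀ n → All (_≤ n) (countdown n)
countdown-≤ zero = []
countdown-≤ (suc n) = ≤-refl ∷ All.map m≤n⇒m≤1+n (countdown-≤ n)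

PegSorted-thetaPeg : ∀ n → PegSorted (applyPegRevs (countdown (suc (suc n))) (thetaPeg (suc (suc n))))
PegSorted-thetaPeg zero = refl , (λ ()) ∷ (λ ()) ∷ []
PegSorted-thetaPeg (suc zero) = refl , (λ ()) ∷ (λ ()) ∷ (λ ()) ∷ []
PegSorted-thetaPeg (suc (suc n)) =
  subst PegSorted (sym (applyPegRevs-extT (suc (suc n)) (thetaPeg (suc (suc n))) (countdown (suc (suc n))) (length-thetaPeg n) (countdown-≤ (suc (suc n)))))
    (PegSorted-++ _ (suc (suc n)) (trans (length-applyPegRevs (countdown (suc (suc n))) (thetaPeg (suc (suc n)))) (length-thetaPeg n)) (PegSorted-thetaPeg n))

thetaPeg-PegSortable : ∀ n → PegSortable (suc (suc n)) (thetaPeg (suc (suc n)))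
thetaPeg-PegSortable n = countdown (suc (suc n)) , ≤-reflexive (length-countdown (suc (suc n))) , PegSorted-thetaPeg n

idPerm-∷ʳ-∷ʳ : ∀ n → idPerm (suc (suc n)) ≡ idPerm n ++ (suc n ∷ suc (suc n) ∷ [])
idPerm-∷ʳ-∷ʳ n = trans (idPerm-∷ʳ (suc n)) (trans (cong (_++ [ suc (suc n) ]) (idPerm-∷ʳ n)) (++-assoc (idPerm n) [ suc n ] [ suc (suc n) ]))

-- idPerm (n + 1) serves as the sequence of reversal lengths 1, 2, …, n + 1.
lambdaPeg-flipReversed : ∀ n → Σ Peg λ r → PegSorted r × (length r ≡ suc (suc n)) ×
  (applyPegRevs (idPerm (suc n)) (lambdaPeg (suc (suc n))) ≡ map flipE (reverse r))
lambdaPeg-flipReversed zero = (1 , dot) ∷ (2 , plus) ∷ [] , (refl , (λ ()) ∷ (λ ()) ∷ []) , refl , refl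
lambdaPeg-flipReversed (suc zero) = (1 , dot) ∷ (2 , plus) ∷ (3 , dot) ∷ [] , (refl , (λ ()) ∷ (λ ()) ∷ (λ ()) ∷ []) , refl , refl
lambdaPeg-flipReversed (suc (suc n)) with lambdaPeg-flipReversed n
... | r , sorted , |r| , reversed =
  sortedExtL (suc (suc n)) r , PegSorted-sortedExtL r (suc (suc n)) |r| sorted ,
  cong suc (trans (length-++-comm (map sucv r) _) (cong suc (trans (length-map sucv r) |r|))) ,
  trans (cong (λ js → applyPegRevs js (lambdaPeg (suc (suc (suc (suc n)))))) (idPerm-∷ʳ-∷ʳ (suc n)))
    (applyPegRevs-extL (suc (suc n)) (lambdaPeg (suc (suc n))) r (idPerm (suc n)) (length-lambdaPeg n)
      (All.map m≤n⇒m≤1+n (↭idPerm-upper (suc n) ↭-refl)) reversed)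

lambdaPeg-PegSortable : ∀ n → PegSortable (suc (suc n)) (lambdaPeg (suc (suc n)))
lambdaPeg-PegSortable n with lambdaPeg-flipReversed n
... | r , sorted , |r| , reversed =
  idPerm (suc (suc n)) , ≤-reflexive (length-idPerm (suc (suc n))) ,
  subst PegSorted (sym finalReversal) sorted
  where
  finalReversal : applyPegRevs (idPerm (suc (suc n))) (lambdaPeg (suc (suc n))) ≡ r
  finalReversal = begin
    applyPegRevs (idPerm (suc (suc n))) (lambdaPeg (suc (suc n)))
      ≡⟨ cong (λ js → applyPegRevs js (lambdaPeg (suc (suc n)))) (idPerm-∷ʳ (suc n)) ⟩
    applyPegRevs (idPerm (suc n) ++ [ suc (suc n) ]) (lambdaPeg (suc (suc n)))
      ≡⟨ applyPegRevs-append (idPerm (suc n)) [ suc (suc n) ] (lambdaPeg (suc (suc n))) ⟩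
    pegPrefRev (suc (suc n)) (applyPegRevs (idPerm (suc n)) (lambdaPeg (suc (suc n))))
      ≡⟨ cong (pegPrefRev (suc (suc n))) reversed ⟩
    pegPrefRev (suc (suc n)) (map flipE (reverse r))
      ≡⟨ pegPrefRev-whole (map flipE (reverse r)) (trans (length-flipReverse r) |r|) ⟩
    map flipE (reverse (map flipE (reverse r)))
      ≡⟨ flipReverse-involutive r ⟩
    r ∎
    where open ≡-Reasoning

≡ᵇ-suc : ∀ x → (suc x ≡ᵇ x) ≡ false
≡ᵇ-suc zero = refl
≡ᵇ-suc (suc x) = ≡ᵇ-suc x

≡ᵇ-+3 : ∀ x → (x ≡ᵇ suc (suc (suc x))) ≡ false
≡ᵇ-+3 zero = refl
≡ᵇ-+3 (suc x) = ≡ᵇ-+3 x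

pegAdj-false : ∀ x y d e → (y ≡ᵇ suc x) ≡ false → (x ≡ᵇ suc y) ≡ false → pegAdj (x , d) (y , e) ≡ false
pegAdj-false x y d e p q rewrite p | q with d | e
... | plus | plus = refl
... | plus | minus = refl
... | plus | dot = refl
... | minus | plus = refl
... | minus | minus = refl
... | minus | dot = refl
... | dot | plus = refl
... | dot | minus = refl
... | dot | dot = refl

pegAdj-+2 : ∀ x d e → pegAdj (x , d) (suc (suc x) , e) ≡ false
pegAdj-+2 x d e = pegAdj-false x (suc (suc x)) d e (≡ᵇ-suc x) (≡ᵇ-+3 x)

pegAdj-∸2 : ∀ x d e → pegAdj (suc (suc x) , d) (x , e) ≡ false
pegAdj-∸2 x d e = pegAdj-false (suc (suc x)) x d e (≡ᵇ-+3 x) (≡ᵇ-suc x)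

adjacencies-extT : ∀ n t e → adjacencies pegAdj (((n , dot) ∷ t) ++ [ (suc n , dot) ]) ≡ 0 →
  adjacencies pegAdj (extT n ((n , dot) ∷ t) ++ [ (suc (suc (suc n)) , e) ]) ≡ 0
adjacencies-extT n t e none = begin
  adjacencies pegAdj (((suc (suc n) , dot) ∷ ((n , dot) ∷ t) ++ [ (suc n , dot) ]) ++ [ (suc (suc (suc n)) , e) ])
    ≡⟨ adjacencies-∷ʳ pegAdj ((suc (suc n) , dot) ∷ ((n , dot) ∷ t)) (suc n , dot) (suc (suc (suc n)) , e) ⟩
  (indicator (pegAdj (suc (suc n) , dot) (n , dot)) + adjacencies pegAdj (((n , dot) ∷ t) ++ [ (suc n , dot) ]))
    + indicator (pegAdj (suc n , dot) (suc (suc (suc n)) , e))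
    ≡⟨ cong₂ (λ a b → (indicator a + b) + indicator (pegAdj (suc n , dot) (suc (suc (suc n)) , e))) (pegAdj-∸2 n dot dot) none ⟩
  indicator (pegAdj (suc n , dot) (suc (suc (suc n)) , e))
    ≡⟨ cong indicator (pegAdj-+2 (suc n) dot e) ⟩
  0 ∎
  where open ≡-Reasoning

thetaPeg-∷ : ∀ n → Σ Peg λ t → thetaPeg (suc (suc n)) ≡ (suc (suc n) , dot) ∷ t
thetaPeg-∷ zero = _ , refl
thetaPeg-∷ (suc zero) = _ , refl
thetaPeg-∷ (suc (suc n)) = _ , refl

adjacencies-thetaPeg : ∀ n e → adjacencies pegAdj (thetaPeg (suc (suc n)) ++ [ (suc (suc (suc n)) , e) ]) ≡ 0
adjacencies-thetaPeg zero plus = refl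
adjacencies-thetaPeg zero minus = refl
adjacencies-thetaPeg zero dot = refl
adjacencies-thetaPeg (suc zero) plus = refl
adjacencies-thetaPeg (suc zero) minus = refl
adjacencies-thetaPeg (suc zero) dot = refl
adjacencies-thetaPeg (suc (suc n)) e with thetaPeg (suc (suc n)) | thetaPeg-∷ n | adjacencies-thetaPeg n dot
... | .(_ ∷ t) | t , refl | none = adjacencies-extT (suc (suc n)) t e none

adjacencies-map-sucv : ∀ xs → adjacencies pegAdj (map sucv xs) ≡ adjacencies pegAdj xs
adjacencies-map-sucv = adjacencies-map pegAdj pegAdj sucv (λ _ _ → refl)

adjacencies-extL : ∀ n p e → adjacencies pegAdj (p ++ [ (suc (suc (suc n)) , dot) ]) ≡ 0 →
  adjacencies pegAdj (extL (suc (suc n)) p ++ [ (suc (suc (suc (suc (suc n)))) , e) ]) ≡ 0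
adjacencies-extL n p e none = begin
    adjacencies pegAdj ((map sucv p ++ ((a , dot) ∷ (1 , dot) ∷ [])) ++ [ (suc a , e) ])
  ≡⟨ cong (λ z → adjacencies pegAdj (z ++ [ (suc a , e) ])) (sym (++-assoc (map sucv p) [ (a , dot) ] [ (1 , dot) ])) ⟩
    adjacencies pegAdj (((map sucv p ++ [ (a , dot) ]) ++ [ (1 , dot) ]) ++ [ (suc a , e) ])
  ≡⟨ adjacencies-∷ʳ pegAdj (map sucv p ++ [ (a , dot) ]) (1 , dot) (suc a , e) ⟩
    adjacencies pegAdj ((map sucv p ++ [ (a , dot) ]) ++ [ (1 , dot) ]) + indicator (pegAdj (1 , dot) (suc a , e))
  ≡⟨ cong₂ _+_ (adjacencies-∷ʳ pegAdj (map sucv p) (a , dot) (1 , dot)) (cong indicator (1-a e)) ⟩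
    (adjacencies pegAdj (map sucv p ++ [ (a , dot) ]) + indicator (pegAdj (a , dot) (1 , dot))) + 0
  ≡⟨ cong (λ z → (z + indicator (pegAdj (a , dot) (1 , dot))) + 0)
       (trans (cong (adjacencies pegAdj) (sym (map-++ sucv p [ (suc (suc (suc n)) , dot) ])))
              (trans (adjacencies-map-sucv (p ++ [ (suc (suc (suc n)) , dot) ])) none)) ⟩
    0
  ∎
  where
  open ≡-Reasoning
  a = suc (suc (suc (suc n)))
  1-a : ∀ e → pegAdj (1 , dot) (suc a , e) ≡ false
  1-a plus = refl
  1-a minus = refl
  1-a dot = refl

adjacencies-lambdaPeg : ∀ n e → adjacencies pegAdj (lambdaPeg (suc (suc n)) ++ [ (suc (suc (suc n)) , e) ]) ≡ 0
adjacencies-lambdaPeg zero plus = refl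
adjacencies-lambdaPeg zero minus = refl
adjacencies-lambdaPeg zero dot = refl
adjacencies-lambdaPeg (suc zero) plus = refl
adjacencies-lambdaPeg (suc zero) minus = refl
adjacencies-lambdaPeg (suc zero) dot = refl
adjacencies-lambdaPeg (suc (suc n)) e = adjacencies-extL n (lambdaPeg (suc (suc n))) e (adjacencies-lambdaPeg n dot)

¬PegSortable-adjacencies : ∀ p n → length p ≡ n → adjacencies pegAdj (p ++ [ (suc n , plus) ]) ≡ 0 → ∀ m → m < n → ¬ PegSortable m p
¬PegSortable-adjacencies p n refl none m m<n sortable = <⇒≱ m<n (begin
  length p                                                 ≤⟨ PegSortable⇒length≤ m p sortable ⟩
  m + adjacencies pegAdj (p ++ [ (suc (length p) , plus) ]) ≡⟨ cong (m +_) none ⟩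
  m + 0                                                    ≡⟨ +-identityʳ m ⟩
  m                                                        ∎)
  where open ≤-Reasoning

length-std : ∀ s → length (std s) ≡ length s
length-std s = length-map _ s

-- Every γ with peg γ = p contains min(p) as a pattern, so min(p) is the only candidate for minimality.
MIsMin-fromMin : ∀ p → InC p (minPeg p) → MIsMin p
MIsMin-fromMin p σ∈C γ = minimal⇒min , min⇒minimal
  where
  σ = minPeg p
  minimal⇒min : InM p γ → γ ≡ σ
  minimal⇒min ((γ-perm , pegγ , _) , minimal) = sym (minimal σ σ∈C (subst (_≼ γ) (cong minPeg pegγ) (minPeg-peg-≼ γ γ-perm)))
  min⇒minimal : γ ≡ σ → InM p γ
  min⇒minimal refl = σ∈C , minimal
    where
    minimal : ∀ δ → InC p δ → δ ≼ σ → δ ≡ σ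
    minimal δ (δ-perm , pegδ , _) (s , s⊆σ , std-s) with subst (_≼ δ) (cong minPeg pegδ) (minPeg-peg-≼ δ δ-perm)
    ... | s' , s'⊆δ , std-s' = trans (sym std-s) (trans (cong std (⊆-length⇒≡ s⊆σ |σ|≤|s|)) (std-IsPerm σ (proj₁ σ∈C)))
      where
      open ≤-Reasoning
      |σ|≤|s| : length σ ≤ length s
      |σ|≤|s| = begin
        length σ         ≡⟨ trans (cong length (sym std-s')) (length-std s') ⟩
        length s'        ≤⟨ SubP.length-mono-≤ s'⊆δ ⟩
        length δ         ≡⟨ trans (cong length (sym std-s)) (length-std s) ⟩
        length s         ∎

InBasis-fromProperPatterns : ∀ k σ → IsPerm σ → ¬ Sortable k σ →
  (∀ s → s ⊆ σ → length s < length σ → ChainSortable _≤_ k s) → InBasis k σ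
InBasis-fromProperPatterns k σ σ-perm unsortable proper = σ-perm , (λ σ∈B → unsortable (proj₂ σ∈B)) , patterns∈B
  where
  patterns∈B : ∀ τ → IsPerm τ → τ ≼ σ → τ ≢ σ → InB k τ
  patterns∈B τ τ-perm (s , s⊆σ , std-s) τ≢σ with length s <? length σ
  ... | yes shorter with proper s s⊆σ shorter
  ...   | js , le , _ , sorted = τ-perm , Sortable-fromPattern k τ-perm std-s js le sorted
  patterns∈B τ τ-perm (s , s⊆σ , std-s) τ≢σ | no ≮ =
    ⊥-elim (τ≢σ (trans (sym std-s) (trans (cong std (⊆-length⇒≡ s⊆σ (≮⇒≥ ≮))) (std-IsPerm σ σ-perm))))

-- σ = min(p) witnesses prd(σ) = prd(p) = m + 1, the lower bounds coming from adjacency counts,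
-- and every proper pattern of σ sorts with m reversals.
MIsMin×InBasis : ∀ (σ : List ℕ) (p : Peg) m →
  IsPerm σ → length σ ≡ suc (suc m) → peg σ ≡ p → All Short (strips σ) →
  ChainSortable _≤_ (suc m) σ → adjacencies adjB (σ ++ [ suc (suc (suc m)) ]) ≡ 1 →
  PegSortable (suc m) p → length p ≡ suc m → adjacencies pegAdj (p ++ [ (suc (suc m) , plus) ]) ≡ 0 →
  (∀ s → s ⊆ σ → length s < length σ → ChainSortable _≤_ m s) →
  MIsMin p × InBasis m (minPeg p)
MIsMin×InBasis σ p m σ-perm |σ| pegσ short σ-sortable σ-adj p-sortable |p| p-adj proper =
  MIsMin-fromMin p (subst (InC p) (sym min≡σ) σ∈C) ,
  subst (InBasis m) (sym min≡σ) (InBasis-fromProperPatterns m σ σ-perm (σ-unsortable m ≤-refl) proper)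
  where
  min≡σ : minPeg p ≡ σ
  min≡σ = trans (cong minPeg (sym pegσ)) (minPeg-peg-short σ σ-perm short)
  σ-unsortable : ∀ k → k < suc m → ¬ Sortable k σ
  σ-unsortable k k<m+1 sortable = <⇒≱ k<m+1 (s≤s⁻¹ (begin
    suc (suc m)                                           ≡⟨ sym |σ| ⟩
    length σ                                              ≤⟨ Sortable⇒length≤ k σ sortable ⟩
    k + adjacencies adjB (σ ++ [ suc (length σ) ])        ≡⟨ trans (cong (λ z → k + adjacencies adjB (σ ++ [ suc z ])) |σ|) (cong (k +_) σ-adj) ⟩
    k + 1                                                 ≡⟨ +-comm k 1 ⟩
    suc k                                                 ∎))
    where open ≤-Reasoning
  σ∈C : InC p σ
  σ∈C = σ-perm , pegσ , suc m , (σ-Sortable , σ-unsortable) , (p-sortable , ¬PegSortable-adjacencies p (suc m) |p| p-adj)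
    where
    σ-Sortable : Sortable (suc m) σ
    σ-Sortable = Sortable-fromPattern (suc m) σ-perm (std-IsPerm σ σ-perm)
      (proj₁ σ-sortable) (proj₁ (proj₂ σ-sortable)) (proj₂ (proj₂ (proj₂ σ-sortable)))

thetaPeg-MIsMin×InBasis : ∀ n → MIsMin (thetaPeg (suc (suc n))) × InBasis (suc n) (minPeg (thetaPeg (suc (suc n))))
thetaPeg-MIsMin×InBasis n =
  MIsMin×InBasis (thetaPerm N) (thetaPeg (suc (suc n))) (suc n)
    (thetaPerm-IsPerm N) (length-thetaPerm N) (peg-thetaPerm n) (thetaPerm-stripsShort n)
    (thetaPerm-ChainSortable N) (adjacencies-thetaPerm (suc (suc n)))
    (thetaPeg-PegSortable n) (length-thetaPeg n) (adjacencies-thetaPeg n plus)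
    (λ s s⊆σ shorter → ⊂thetaPerm-ChainSortable N s s⊆σ (subst (length s <_) (length-thetaPerm N) shorter))
  where N = suc (suc (suc n))

lambdaPeg-MIsMin×InBasis : ∀ n → MIsMin (lambdaPeg (suc (suc n))) × InBasis (suc n) (minPeg (lambdaPeg (suc (suc n))))
lambdaPeg-MIsMin×InBasis n =
  MIsMin×InBasis (lambdaPerm N) (lambdaPeg (suc (suc n))) (suc n)
    (lambdaPerm-IsPerm N) (length-lambdaPerm N) (peg-lambdaPerm n) (lambdaPerm-stripsShort n)
    (lambdaPerm-ChainSortable N) (adjacencies-lambdaPerm (suc n))
    (lambdaPeg-PegSortable n) (length-lambdaPeg n) (adjacencies-lambdaPeg n plus)
    (λ s s⊆σ shorter → ⊂lambdaPerm-ChainSortable N s s⊆σ (subst (length s <_) (length-lambdaPerm N) shorter))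
  where N = suc (suc (suc n))

-- Θe n, Λe n, Θo n and Λo n unfold definitionally to these functions of n / 2.
ΘeAt : ℕ → Peg
ΘeAt t = map (λ i → dotE (2 * (t ∸ i))) (upTo t) ++ ((1 , plus) ∷ map (λ i → dotE (2 * i + 3)) (upTo (t ∸ 1)))

ΛeAt : ℕ → Peg
ΛeAt t = concatMap (λ i → (t + suc i , (if i ≡ᵇ 0 then plus else dot)) ∷ dotE (t ∸ i) ∷ []) (upTo t)

ΘoAt : ℕ → Peg
ΘoAt s = map (λ i → dotE (2 * (s ∸ i) + 1)) (upTo s) ++ ((1 , minus) ∷ map (λ i → dotE (2 * suc i)) (upTo s))

ΛoAt : ℕ → Peg
ΛoAt s = (suc s , minus) ∷ concatMap (λ i → dotE (suc s + suc i) ∷ dotE (suc s ∸ suc i) ∷ []) (upTo s)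

map-upTo-suc : ∀ {A : Set} (f : ℕ → A) t → map f (upTo (suc t)) ≡ f 0 ∷ map (λ i → f (suc i)) (upTo t)
map-upTo-suc f t = cong (f 0 ∷_) (trans (map-applyUpTo suc f t) (sym (map-applyUpTo id (λ i → f (suc i)) t)))

map-upTo-∷ʳ : ∀ {A : Set} (f : ℕ → A) t → map f (upTo (suc t)) ≡ map f (upTo t) ++ [ f t ]
map-upTo-∷ʳ f t = trans (cong (map f) (sym (upTo-∷ʳ t))) (map-++ f (upTo t) [ t ])

applyUpTo-cong< : ∀ {A : Set} (f g : ℕ → A) n → (∀ i → i < n → f i ≡ g i) → applyUpTo f n ≡ applyUpTo g n
applyUpTo-cong< f g zero f≡g = refl
applyUpTo-cong< f g (suc n) f≡g =
  cong₂ _∷_ (f≡g 0 (s≤s z≤n)) (applyUpTo-cong< (λ i → f (suc i)) (λ i → g (suc i)) n (λ i i<n → f≡g (suc i) (s≤s i<n)))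

map-upTo-cong< : ∀ {A : Set} (f g : ℕ → A) n → (∀ i → i < n → f i ≡ g i) → map f (upTo n) ≡ map g (upTo n)
map-upTo-cong< f g n f≡g = trans (map-applyUpTo id f n) (trans (applyUpTo-cong< f g n f≡g) (sym (map-applyUpTo id g n)))

m+m≡m*2 : ∀ m → m + m ≡ m * 2
m+m≡m*2 m = sym (trans (*-comm m 2) (cong (m +_) (+-identityʳ m)))

ΘeAt-step : ∀ k → ΘeAt (suc (suc k)) ≡ extT (suc (suc (k * 2))) (ΘeAt (suc k))
ΘeAt-step k = begin
  ΘeAt (suc (suc k))
    ≡⟨ cong₂ _++_ (map-upTo-suc (λ i → dotE (2 * (suc (suc k) ∸ i))) (suc k))
                  (cong ((1 , plus) ∷_) (map-upTo-∷ʳ (λ i → dotE (2 * i + 3)) k)) ⟩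
  (2 * suc (suc k) , dot) ∷ (front ++ ((1 , plus) ∷ back ++ [ dotE (2 * k + 3) ]))
    ≡⟨ cong ((2 * suc (suc k) , dot) ∷_) (sym (++-assoc front ((1 , plus) ∷ back) [ dotE (2 * k + 3) ])) ⟩
  (2 * suc (suc k) , dot) ∷ (ΘeAt (suc k) ++ [ dotE (2 * k + 3) ])
    ≡⟨ cong₂ (λ a b → (a , dot) ∷ (ΘeAt (suc k) ++ [ (b , dot) ])) (*-comm 2 (suc (suc k)))
         (trans (+-comm (2 * k) 3) (cong (λ z → suc (suc (suc z))) (*-comm 2 k))) ⟩
  extT (suc (suc (k * 2))) (ΘeAt (suc k)) ∎
  where
  open ≡-Reasoning
  front = map (λ i → dotE (2 * (suc k ∸ i))) (upTo (suc k))
  back = map (λ i → dotE (2 * i + 3)) (upTo k)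

ΘoAt-step : ∀ k → ΘoAt (suc (suc k)) ≡ extT (suc (suc (suc (k * 2)))) (ΘoAt (suc k))
ΘoAt-step k = begin
  ΘoAt (suc (suc k))
    ≡⟨ cong₂ _++_ (map-upTo-suc (λ i → dotE (2 * (suc (suc k) ∸ i) + 1)) (suc k))
                  (cong ((1 , minus) ∷_) (map-upTo-∷ʳ (λ i → dotE (2 * suc i)) (suc k))) ⟩
  (2 * suc (suc k) + 1 , dot) ∷ (front ++ ((1 , minus) ∷ back ++ [ dotE (2 * suc (suc k)) ]))
    ≡⟨ cong ((2 * suc (suc k) + 1 , dot) ∷_) (sym (++-assoc front ((1 , minus) ∷ back) [ dotE (2 * suc (suc k)) ])) ⟩
  (2 * suc (suc k) + 1 , dot) ∷ (ΘoAt (suc k) ++ [ dotE (2 * suc (suc k)) ])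
    ≡⟨ cong₂ (λ a b → (a , dot) ∷ (ΘoAt (suc k) ++ [ (b , dot) ]))
         (trans (+-comm (2 * suc (suc k)) 1) (cong suc (*-comm 2 (suc (suc k))))) (*-comm 2 (suc (suc k))) ⟩
  extT (suc (suc (suc (k * 2)))) (ΘoAt (suc k)) ∎
  where
  open ≡-Reasoning
  front = map (λ i → dotE (2 * (suc k ∸ i) + 1)) (upTo (suc k))
  back = map (λ i → dotE (2 * suc i)) (upTo (suc k))

-- Splitting off the last pair of entries leaves the pairs of ΛeAt (t - 1), shifted up by one.
ΛeAt-step : ∀ k → ΛeAt (suc (suc k)) ≡ extL (suc (suc (k * 2))) (ΛeAt (suc k))
ΛeAt-step k = begin
  concatMap (pair (suc (suc k))) (upTo (suc (suc k)))
    ≡⟨ cong (concatMap (pair (suc (suc k)))) (sym (upTo-∷ʳ (suc k))) ⟩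
  concatMap (pair (suc (suc k))) (upTo (suc k) ++ [ suc k ])
    ≡⟨ concatMap-++ (pair (suc (suc k))) (upTo (suc k)) [ suc k ] ⟩
  concatMap (pair (suc (suc k))) (upTo (suc k)) ++ concatMap (pair (suc (suc k))) [ suc k ]
    ≡⟨ cong₂ _++_ shifted (trans (++-identityʳ _) (cong₂ (λ a b → (a , dot) ∷ (b , dot) ∷ []) (m+m≡m*2 (suc (suc k))) (m+n∸n≡m 1 (suc k)))) ⟩
  extL (suc (suc (k * 2))) (ΛeAt (suc k)) ∎
  where
  open ≡-Reasoning
  pair : ℕ → ℕ → List (ℕ × Deco)
  pair t i = (t + suc i , (if i ≡ᵇ 0 then plus else dot)) ∷ dotE (t ∸ i) ∷ []
  shifted : concatMap (pair (suc (suc k))) (upTo (suc k)) ≡ map sucv (ΛeAt (suc k))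
  shifted = trans (cong concat (map-upTo-cong< (pair (suc (suc k))) (λ i → map sucv (pair (suc k) i)) (suc k)
      (λ i i<k+1 → cong (λ z → (suc (suc k) + suc i , (if i ≡ᵇ 0 then plus else dot)) ∷ (z , dot) ∷ []) (+-∸-assoc 1 (<⇒≤ i<k+1)))))
    (sym (map-concatMap sucv (pair (suc k)) (upTo (suc k))))

ΛoAt-step : ∀ k → ΛoAt (suc (suc k)) ≡ extL (suc (suc (suc (k * 2)))) (ΛoAt (suc k))
ΛoAt-step k = cong ((suc (suc (suc k)) , minus) ∷_) (begin
  concatMap (pair (suc (suc k))) (upTo (suc (suc k)))
    ≡⟨ cong (concatMap (pair (suc (suc k)))) (sym (upTo-∷ʳ (suc k))) ⟩
  concatMap (pair (suc (suc k))) (upTo (suc k) ++ [ suc k ])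
    ≡⟨ concatMap-++ (pair (suc (suc k))) (upTo (suc k)) [ suc k ] ⟩
  concatMap (pair (suc (suc k))) (upTo (suc k)) ++ concatMap (pair (suc (suc k))) [ suc k ]
    ≡⟨ cong₂ _++_ shifted (trans (++-identityʳ _) (cong₂ (λ a b → (a , dot) ∷ (b , dot) ∷ []) (cong suc (m+m≡m*2 (suc (suc k)))) (m+n∸n≡m 1 (suc k)))) ⟩
  map sucv (concatMap (pair (suc k)) (upTo (suc k))) ++ ((suc (suc (suc (suc (suc (k * 2))))) , dot) ∷ (1 , dot) ∷ []) ∎)
  where
  open ≡-Reasoning
  pair : ℕ → ℕ → List (ℕ × Deco)
  pair s i = dotE (suc s + suc i) ∷ dotE (suc s ∸ suc i) ∷ []
  shifted : concatMap (pair (suc (suc k))) (upTo (suc k)) ≡ map sucv (concatMap (pair (suc k)) (upTo (suc k)))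
  shifted = trans (cong concat (map-upTo-cong< (pair (suc (suc k))) (λ i → map sucv (pair (suc k) i)) (suc k)
      (λ i i<k+1 → cong (λ z → (suc (suc (suc k)) + suc i , dot) ∷ (z , dot) ∷ []) (+-∸-assoc 1 (<⇒≤ i<k+1)))))
    (sym (map-concatMap sucv (pair (suc k)) (upTo (suc k))))

ΘeAt-thetaPeg : ∀ k → ΘeAt (suc k) ≡ thetaPeg (suc (suc (k * 2)))
ΘeAt-thetaPeg zero = refl
ΘeAt-thetaPeg (suc k) = trans (ΘeAt-step k) (cong (extT (suc (suc (k * 2)))) (ΘeAt-thetaPeg k))

ΛeAt-lambdaPeg : ∀ k → ΛeAt (suc k) ≡ lambdaPeg (suc (suc (k * 2)))
ΛeAt-lambdaPeg zero = refl
ΛeAt-lambdaPeg (suc k) = trans (ΛeAt-step k) (cong (extL (suc (suc (k * 2)))) (ΛeAt-lambdaPeg k))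

ΘoAt-thetaPeg : ∀ k → ΘoAt (suc k) ≡ thetaPeg (suc (suc (suc (k * 2))))
ΘoAt-thetaPeg zero = refl
ΘoAt-thetaPeg (suc k) = trans (ΘoAt-step k) (cong (extT (suc (suc (suc (k * 2))))) (ΘoAt-thetaPeg k))

ΛoAt-lambdaPeg : ∀ k → ΛoAt (suc k) ≡ lambdaPeg (suc (suc (suc (k * 2))))
ΛoAt-lambdaPeg zero = refl
ΛoAt-lambdaPeg (suc k) = trans (ΛoAt-step k) (cong (extL (suc (suc (suc (k * 2))))) (ΛoAt-lambdaPeg k))

even⇒2+2k : ∀ n → 2 ≤ n → 2 ∣ n → Σ ℕ λ k → (n ≡ suc (suc (k * 2))) × (n / 2 ≡ suc k)
even⇒2+2k n 2≤n (divides zero refl) = ⊥-elim (<⇒≱ 2≤n z≤n)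
even⇒2+2k n _ (divides (suc k) refl) = k , refl , DM.m*n/n≡m (suc k) 2

odd⇒1+[n/2]*2 : ∀ n → ¬ (2 ∣ n) → n ≡ suc ((n / 2) * 2)
odd⇒1+[n/2]*2 n 2∤n = trans (DM.m≡m%n+[m/n]*n n 2) (cong (_+ (n / 2) * 2) n%2≡1)
  where
  n%2≡1 : n % 2 ≡ 1
  n%2≡1 with n % 2 | DM.m%n<n n 2 | Div.m%n≡0⇒n∣m n 2
  ... | zero | _ | 2∣n = ⊥-elim (2∤n (2∣n refl))
  ... | suc zero | _ | _ = refl
  ... | suc (suc _) | s≤s (s≤s ()) | _

odd⇒3+2k : ∀ n → 3 ≤ n → ¬ (2 ∣ n) → Σ ℕ λ k → (n ≡ suc (suc (suc (k * 2)))) × (n / 2 ≡ suc k)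
odd⇒3+2k n 3≤n 2∤n with n / 2 | odd⇒1+[n/2]*2 n 2∤n
... | zero | refl = ⊥-elim (<⇒≱ 3≤n (s≤s z≤n))
... | suc k | n≡ = k , n≡ , refl

Θe-thetaPeg : ∀ n k → n / 2 ≡ suc k → Θe n ≡ thetaPeg (suc (suc (k * 2)))
Θe-thetaPeg n k half = trans (cong ΘeAt half) (ΘeAt-thetaPeg k)

Λe-lambdaPeg : ∀ n k → n / 2 ≡ suc k → Λe n ≡ lambdaPeg (suc (suc (k * 2)))
Λe-lambdaPeg n k half = trans (cong ΛeAt half) (ΛeAt-lambdaPeg k)

Θo-thetaPeg : ∀ n k → n / 2 ≡ suc k → Θo n ≡ thetaPeg (suc (suc (suc (k * 2))))
Θo-thetaPeg n k half = trans (cong ΘoAt half) (ΘoAt-thetaPeg k)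

Λo-lambdaPeg : ∀ n k → n / 2 ≡ suc k → Λo n ≡ lambdaPeg (suc (suc (suc (k * 2))))
Λo-lambdaPeg n k half = trans (cong ΛoAt half) (ΛoAt-lambdaPeg k)

MIsMin×InBasis-both : ∀ {m p p' q q'} → p ≡ p' → q ≡ q' →
  MIsMin p' × InBasis m (minPeg p') → MIsMin q' × InBasis m (minPeg q') →
  MIsMin p × MIsMin q × InBasis m (minPeg p) × InBasis m (minPeg q)
MIsMin×InBasis-both refl refl (p-min , p-basis) (q-min , q-basis) = p-min , q-min , p-basis , q-basis

mainTheorem9 :
    (∀ n → 2 ≤ n → 2 ∣ n →
      MIsMin (Θe n) × MIsMin (Λe n) ×
      InBasis (n ∸ 1) (minPeg (Θe n)) × InBasis (n ∸ 1) (minPeg (Λe n)))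
    ×
    (∀ n → 3 ≤ n → ¬ (2 ∣ n) →
      MIsMin (Θo n) × MIsMin (Λo n) ×
      InBasis (n ∸ 1) (minPeg (Θo n)) × InBasis (n ∸ 1) (minPeg (Λo n)))
mainTheorem9 = even , odd
  where
  even : ∀ n → 2 ≤ n → 2 ∣ n → MIsMin (Θe n) × MIsMin (Λe n) × InBasis (n ∸ 1) (minPeg (Θe n)) × InBasis (n ∸ 1) (minPeg (Λe n))
  even n 2≤n 2∣n with even⇒2+2k n 2≤n 2∣n
  ... | k , refl , half = MIsMin×InBasis-both (Θe-thetaPeg n k half) (Λe-lambdaPeg n k half)
    (thetaPeg-MIsMin×InBasis (k * 2)) (lambdaPeg-MIsMin×InBasis (k * 2))
  odd : ∀ n → 3 ≤ n → ¬ (2 ∣ n) → MIsMin (Θo n) × MIsMin (Λo n) × InBasis (n ∸ 1) (minPeg (Θo n)) × InBasis (n ∸ 1) (minPeg (Λo n))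
  odd n 3≤n 2∤n with odd⇒3+2k n 3≤n 2∤n
  ... | k , refl , half = MIsMin×InBasis-both (Θo-thetaPeg n k half) (Λo-lambdaPeg n k half)
    (thetaPeg-MIsMin×InBasis (suc (k * 2))) (lambdaPeg-MIsMin×InBasis (suc (k * 2)))
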